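{- Let $G$ be a graph (possibly with loops). Then $h(G)\le 1$ if and only if $G$ contains none of the following as a subgraph: a cycle; two distinct vertices each carrying a loop and joined by a path; the graph $H_1$ consisting of paths $c_1b_1a_1xa_2b_2c_2$ and $xa_3b_3c_3$ (distinct vertices); the graph $H_2$ consisting of paths $c_1b_1a_1xa_2b_2c_2$ and $xa_3b_3$ together with a loop at $b_3$; the graph $H_3$ consisting of the path $c_1b_1a_1xa_2b_2c_2$ and the edge $xa_3$ together with a loop at $a_3$; the graph $H_4$ consisting of the path $c_1b_1a_1xa_2b_2c_2$ together with a loop at $x$.
   Context: All graphs are finite and undirected, have no parallel edges and no isolated vertices, and may contain loops; a cycle means a cycle in the usual sense (length at least 3), loops not counting as cycles. For $A\subseteq V(G)$, $N(A)$ is the set of vertices having at least one neighbor in $A$ (a vertex with a loop is its own neighbor). Hunters and rabbit game on $G=(V,E)$: a hunter strategy is a sequence $(W_t)_{t\ge1}$ of subsets of $V$. The rabbit territory is $R_1=V\setminus W_1$ and $R_t=N(R_{t-1})\setminus W_t$ for $t\ge2$. The strategy is winning if $R_T=\emptyset$ for some finite $T$, and uses $k$ hunters if $|W_t|\le k$ for all $t$. The hunting number $h(G)$ is the minimum $k$ such that a winning strategy using $k$ hunters exists. -}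

module Defs where

open import Data.Nat using (ℕ; zero; suc; _≤_)
open import Data.Fin using (Fin; zero; suc; inject₁; fromℕ; #_)
open import Data.Fin.Subset using (Subset; _∈_; _∉_; ∣_∣)
open import Data.Bool using (Bool; true)
open import Data.Product using (Σ; ∃; ∃-syntax; _×_; _,_)
open import Data.List using (List; []; _∷_)
open import Data.List.Relation.Unary.All using (All)
open import Relation.Binary.PropositionalEquality using (_≡_)
open import Relation.Nullary using (¬_)
open import Function.Definitions using (Injective)

-- A finite undirected graph on vertex set Fin n, possibly with loops
-- (adj v v ≡ true means a loop at v), no parallel edges (adjacency is a
-- relation), and no isolated vertices.
record Graph (n : ℕ) : Set where
  field
    adj        : Fin n → Fin n → Bool
    symmetric  : ∀ u v → adj u v ≡ adj v u
    noIsolated : ∀ v → ∃[ u ] adj v u ≡ true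

module _ {n : ℕ} (G : Graph n) where
  open Graph G

  Adj : Fin n → Fin n → Set
  Adj u v = adj u v ≡ true

  -- A hunter strategy: W t is the set of hunted vertices at round t+1.
  Strategy : Set
  Strategy = ℕ → Subset n

  Territory : Strategy → ℕ → Fin n → Set
  Territory W zero    v = v ∉ W zero
  Territory W (suc t) v = (∃[ u ] (Territory W t u × Adj u v)) × v ∉ W (suc t)

  Winning : Strategy → Set
  Winning W = ∃[ T ] (∀ v → ¬ Territory W T v)

  UsesHunters : ℕ → Strategy → Set
  UsesHunters k W = ∀ t → ∣ W t ∣ ≤ k

  HuntingNumber≤ : ℕ → Set
  HuntingNumber≤ k = Σ Strategy λ W → Winning W × UsesHunters k W

  ContainsCycle : Set
  ContainsCycle =
    ∃[ k ] (2 ≤ k × Σ (Fin (suc k) → Fin n) λ f →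
      Injective _≡_ _≡_ f ×
      (∀ (i : Fin k) → Adj (f (inject₁ i)) (f (suc i))) ×
      Adj (f (fromℕ k)) (f zero))

  ContainsLoopedPath : Set
  ContainsLoopedPath =
    ∃[ k ] (Σ (Fin (suc (suc k)) → Fin n) λ f →
      Injective _≡_ _≡_ f ×
      (∀ (i : Fin (suc k)) → Adj (f (inject₁ i)) (f (suc i))) ×
      Adj (f zero) (f zero) ×
      Adj (f (fromℕ (suc k))) (f (fromℕ (suc k))))

  -- G contains the pattern graph on Fin m with edge list es (loops as (i , i))
  -- as a subgraph: an injective vertex map sending edges to edges.
  ContainsPattern : (m : ℕ) → List (Fin m × Fin m) → Set
  ContainsPattern m es =
    Σ (Fin m → Fin n) λ f →
      Injective _≡_ _≡_ f × All (λ { (i , j) → Adj (f i) (f j) }) es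

-- Vertex numbering: x=0, a1=1, b1=2, c1=3, a2=4, b2=5, c2=6, a3=7, b3=8, c3=9.
-- H1: paths c1b1a1xa2b2c2 and xa3b3c3.
H1 : List (Fin 10 × Fin 10)
H1 = (# 3 , # 2) ∷ (# 2 , # 1) ∷ (# 1 , # 0) ∷ (# 0 , # 4) ∷ (# 4 , # 5) ∷ (# 5 , # 6)
   ∷ (# 0 , # 7) ∷ (# 7 , # 8) ∷ (# 8 , # 9) ∷ []

H2 : List (Fin 9 × Fin 9)
H2 = (# 3 , # 2) ∷ (# 2 , # 1) ∷ (# 1 , # 0) ∷ (# 0 , # 4) ∷ (# 4 , # 5) ∷ (# 5 , # 6)
   ∷ (# 0 , # 7) ∷ (# 7 , # 8) ∷ (# 8 , # 8) ∷ []

H3 : List (Fin 8 × Fin 8)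
H3 = (# 3 , # 2) ∷ (# 2 , # 1) ∷ (# 1 , # 0) ∷ (# 0 , # 4) ∷ (# 4 , # 5) ∷ (# 5 , # 6)
   ∷ (# 0 , # 7) ∷ (# 7 , # 7) ∷ []

H4 : List (Fin 7 × Fin 7)
H4 = (# 3 , # 2) ∷ (# 2 , # 1) ∷ (# 1 , # 0) ∷ (# 0 , # 4) ∷ (# 4 , # 5) ∷ (# 5 , # 6)
   ∷ (# 0 , # 0) ∷ []

{-# OPTIONS --safe #-}
-- Only if: in each forbidden subgraph the rabbit keeps away from a single hunter. In a cycle or a path
-- with looped ends every vertex has two neighbours inside it, so the rabbit only has to avoid the vertex
-- being shot; for H1, …, H4 an explicit family of refuges is checked by evaluation.
--
-- If: grow a path, the spine, in a component (starting at its looped vertex, if any) as long as some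
-- vertex lies at distance 3 from it; such a vertex either lengthens the spine or yields a forbidden
-- subgraph. Once it stops, the component is a lobster: every vertex is on the spine, a hair next to it or
-- a tip next to a hair, and with no cycles the graph is properly 2-coloured apart from a loop at the start
-- of the spine. The hunter sweeps the lobster from the end of the spine to its start and back, shooting
-- each spine vertex and then each of its hairs; after the first sweep the rabbit has the parity opposite
-- to the hunter's, and the second sweep catches it. Components are cleared one after another.
module Submission where

open import Defs
open import Data.Nat using (ℕ; zero; suc; pred; _+_; _∸_; _≤_; _<_; z≤n; s≤s; _<?_; _≤?_)
open import Data.Nat.Properties using (≤-refl; ≤-trans; <-≤-trans)
import Data.Nat.Properties as NP
open import Data.Fin using (Fin; zero; suc; toℕ; inject₁; fromℕ; fromℕ<; #_)
import Data.Fin as F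
import Data.Fin.Properties as FP
open import Data.Fin.Subset as Subset using (Subset; ⁅_⁆; ∣_∣; _-_)
import Data.Fin.Subset.Properties as SubsetP
open import Data.Bool using (Bool; true; false; not)
import Data.Bool as B
import Data.Bool.Properties as BoolP
open import Data.Product using (∃; ∃₂; ∃-syntax; _×_; _,_; proj₁; proj₂)
import Data.Product.Properties as ×P
open import Data.Sum using (_⊎_; inj₁; inj₂; [_,_]′)
open import Data.Empty using (⊥; ⊥-elim)
open import Data.Unit using (tt)
import Data.Vec as Vec
open import Data.Vec using (_∷_; [])
open import Data.List
  using (List; []; _∷_; _++_; [_]; _∷ʳ_; length; take; foldl; lookup; map; applyUpTo; filter; allFin)
open import Data.List.Relation.Unary.Linked using (Linked; []; [-]; _∷_)
open import Data.List.Relation.Unary.Unique.Propositional using (Unique)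
open import Data.List.Relation.Unary.AllPairs using ([]; _∷_)
open import Data.List.Membership.Propositional.Properties
  using (∈-lookup; ∈-applyUpTo⁻; ∈-filter⁺; ∈-filter⁻; ∈-allFin)
import Data.List.Relation.Unary.Unique.Propositional.Properties as UniqueP
import Data.List.Relation.Unary.Linked.Properties as LinkedP
import Data.List.Properties as ListP
open import Data.List.Membership.Propositional using (_∈_; _∉_; find)
open import Data.List.Membership.DecPropositional using (_∈?_)
open import Data.List.Relation.Unary.All as All using (All; []; _∷_)
open import Data.List.Relation.Unary.Any as Any using (Any; here; there)
import Data.List.Relation.Unary.Any.Properties as AnyP
open import Relation.Binary.Definitions using (tri<; tri≈; tri>)
open import Relation.Binary.Construct.Closure.ReflexiveTransitive as Star using (Star; ε; _◅_; _◅◅_)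
open import Relation.Binary.PropositionalEquality using (_≡_; _≢_; refl; sym; trans; cong; subst; ≢-sym)
open import Relation.Nullary using (¬_; Dec; yes; no; contradiction)
open import Relation.Nullary.Decidable as Dec using (True; toWitness; _×-dec_; _⊎-dec_; _→-dec_; ¬?)
open import Relation.Unary using (Pred; U; _⊆_; _∪_; _∖_; Decidable)
open import Level using (0ℓ)
open import Function.Definitions using (Injective)
open import Function.Bundles using (_⇔_; mk⇔)
open import Function using (_∘_)

∣p∣≤1⇒∈-unique : ∀ {m} {p : Subset m} → ∣ p ∣ ≤ 1 → ∀ {x y} → x Subset.∈ p → y Subset.∈ p → x ≡ y
∣p∣≤1⇒∈-unique {p = p} ∣p∣≤1 {x} {y} x∈p y∈p with x F.≟ y
... | yes x≡y = x≡y
... | no x≢y = contradiction (≤-trans 1<∣p∣ ∣p∣≤1) λ { (s≤s ()) }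
  where
  0<∣p-x∣ : 0 < ∣ p - x ∣
  0<∣p-x∣ = ≤-trans (s≤s z≤n) (SubsetP.x∈p⇒∣p-x∣<∣p∣ (SubsetP.x∈p∧x≢y⇒x∈p-y y∈p (λ y≡x → x≢y (sym y≡x))))
  1<∣p∣ : 1 < ∣ p ∣
  1<∣p∣ = <-≤-trans (s≤s 0<∣p-x∣) (SubsetP.x∈p⇒∣p-x∣<∣p∣ x∈p)

data LastOrInner : ∀ {k} → Fin (suc k) → Set where
  last  : ∀ {k} → LastOrInner (fromℕ k)
  inner : ∀ {k} (i : Fin k) → LastOrInner (inject₁ i)

lastOrInner : ∀ {k} (i : Fin (suc k)) → LastOrInner i
lastOrInner {zero}  zero    = last
lastOrInner {suc k} zero    = inner zero
lastOrInner {suc k} (suc i) with lastOrInner i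
... | last     = last
... | inner i' = inner (suc i')

module _ {A : Set} where

  last′ : A → List A → A
  last′ x []       = x
  last′ _ (y ∷ ys) = last′ y ys

  last′-++ : ∀ x xs ys → last′ x (xs ++ ys) ≡ last′ (last′ x xs) ys
  last′-++ x []       ys = refl
  last′-++ _ (y ∷ xs) ys = last′-++ y xs ys

  last′-applyUpTo : ∀ (f : ℕ → A) k → last′ (f 0) (applyUpTo (λ t → f (suc t)) k) ≡ f k
  last′-applyUpTo f zero    = refl
  last′-applyUpTo f (suc k) = last′-applyUpTo (λ t → f (suc t)) k

  lookup-last : ∀ x ys → lookup (x ∷ ys) (fromℕ (length ys)) ≡ last′ x ys
  lookup-last x []       = refl
  lookup-last _ (y ∷ ys) = lookup-last y ys

  lookup-injective : ∀ {xs : List A} → Unique xs → Injective _≡_ _≡_ (lookup xs)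
  lookup-injective {x ∷ xs} (x∉xs ∷ u) {zero}  {zero}  _ = refl
  lookup-injective {x ∷ xs} (x∉xs ∷ u) {zero}  {suc j} e = ⊥-elim (All.lookup x∉xs (∈-lookup j) e)
  lookup-injective {x ∷ xs} (x∉xs ∷ u) {suc i} {zero}  e = ⊥-elim (All.lookup x∉xs (∈-lookup i) (sym e))
  lookup-injective {x ∷ xs} (x∉xs ∷ u) {suc i} {suc j} e = cong suc (lookup-injective u e)

  module _ {R : A → A → Set} where

    linked-++ : ∀ {x xs ys} → Linked R (x ∷ xs) → Linked R (last′ x xs ∷ ys) → Linked R (x ∷ xs ++ ys)
    linked-++ {xs = []}     _       l' = l'
    linked-++ {xs = _ ∷ _} (r ∷ l) l' = r ∷ linked-++ l l'

    linked-lookup : ∀ {x ys} → Linked R (x ∷ ys) →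
                    ∀ (i : Fin (length ys)) → R (lookup (x ∷ ys) (inject₁ i)) (lookup (x ∷ ys) (suc i))
    linked-lookup (r ∷ _) zero    = r
    linked-lookup (_ ∷ l) (suc i) = linked-lookup l i

injective? : ∀ {m k} (π : Fin m → Fin k) → Dec (Injective _≡_ _≡_ π)
injective? π = Dec.map′ (λ inj {i} {j} → inj i j) (λ inj i j → inj)
  (FP.all? λ i → FP.all? λ j → (π i F.≟ π j) →-dec (i F.≟ j))

∸-suc : ∀ {L a} → suc a ≤ L → L ∸ a ≡ suc (L ∸ suc a)
∸-suc = NP.+-∸-assoc 1

≢∧≢⇒≡ : ∀ {a b c : Bool} → a ≢ b → a ≢ c → b ≡ c
≢∧≢⇒≡ a≢b a≢c = trans (BoolP.¬-not (≢-sym a≢b)) (sym (BoolP.¬-not (≢-sym a≢c)))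

module Graphs {n : ℕ} (G : Graph n) where
  open Graph G using (adj; symmetric)

  Adj-sym : ∀ {u v} → Adj G u v → Adj G v u
  Adj-sym {u} {v} e = trans (symmetric v u) e

  Adj? : ∀ u v → Dec (Adj G u v)
  Adj? u v = adj u v B.≟ true

  Region : Set₁
  Region = Pred (Fin n) 0ℓ

  Closed : Region → Set
  Closed C = ∀ {u v} → C u → Adj G u v → C v

  star-closed : ∀ {A x y} → Closed A → A x → Star (Adj G) x y → A y
  star-closed clA x∈A ε          = x∈A
  star-closed clA x∈A (a ◅ path) = star-closed clA (clA x∈A a) path

  ∖-closed : ∀ {A C} → Closed A → Closed C → Closed (A ∖ C)
  ∖-closed clA clC (u∈A , u∉C) a = clA u∈A a , λ v∈C → u∉C (clC v∈C (Adj-sym a))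

  reverse-path : ∀ {L} (f : ℕ → Fin n) → (∀ {i} → suc i ≤ L → Adj G (f i) (f (suc i))) →
                 ∀ {i} → suc i ≤ L → Adj G (f (L ∸ i)) (f (L ∸ suc i))
  reverse-path {L} f path {i} si≤L = subst (λ k → Adj G (f k) (f (L ∸ suc i))) (sym (∸-suc si≤L))
                                       (Adj-sym (path (subst (_≤ L) (∸-suc si≤L) (NP.m∸n≤m L i))))

module Shooting {n : ℕ} (G : Graph n) where
  open Graph G using (noIsolated)
  open Graphs G

  shoot : Region → Fin n → Region
  shoot R w v = (∃[ u ] (R u × Adj G u v)) × v ≢ w

  after : Region → List (Fin n) → Region
  after = foldl shoot

  Clears : Region → List (Fin n) → Set
  Clears R ws = ∀ v → ¬ after R ws v

  after-mono : ∀ {R R'} ws → R ⊆ R' → after R ws ⊆ after R' ws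
  after-mono []       R⊆R' = R⊆R'
  after-mono (w ∷ ws) R⊆R' = after-mono ws λ { ((u , u∈R , a) , v≢w) → (u , R⊆R' u∈R , a) , v≢w }

  after-closed : ∀ {C R} ws → Closed C → R ⊆ C → after R ws ⊆ C
  after-closed []       _   R⊆C = R⊆C
  after-closed (w ∷ ws) clC R⊆C = after-closed ws clC λ { ((u , u∈R , a) , _) → clC (R⊆C u∈R) a }

  after-∪ : ∀ {R R'} ws → after (R ∪ R') ws ⊆ after R ws ∪ after R' ws
  after-∪ []       v∈R∪R' = v∈R∪R'
  after-∪ (w ∷ ws) v∈after = after-∪ ws (after-mono ws split v∈after)
    where
    split : ∀ {R R'} → shoot (R ∪ R') w ⊆ shoot R w ∪ shoot R' w
    split ((u , inj₁ u∈R  , a) , v≢w) = inj₁ ((u , u∈R  , a) , v≢w)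
    split ((u , inj₂ u∈R' , a) , v≢w) = inj₂ ((u , u∈R' , a) , v≢w)

  -- No edge leaves the closed set C, so once C is cleared the rabbit is confined to A ∖ C.
  clears-++ : ∀ {A C} → Decidable C → Closed A → Closed C →
              ∀ xs ys → Clears C xs → Clears (A ∖ C) ys → Clears A (xs ++ ys)
  clears-++ {A} {C} C? clA clC xs ys clearC clearA∖C v v∈after
    rewrite ListP.foldl-++ shoot A xs ys = clearA∖C v (after-mono ys confined v∈after)
    where
    divide : A ⊆ C ∪ (A ∖ C)
    divide {u} u∈A with C? u
    ... | yes u∈C = inj₁ u∈C
    ... | no  u∉C = inj₂ (u∈A , u∉C)
    confined : after A xs ⊆ A ∖ C
    confined {u} u∈after with after-∪ xs (after-mono xs divide u∈after)
    ... | inj₁ u∈afterC   = ⊥-elim (clearC u u∈afterC)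
    ... | inj₂ u∈afterA∖C = after-closed xs (∖-closed clA clC) (λ w∈A∖C → w∈A∖C) u∈afterA∖C

  hunterAt : List (Fin n) → Strategy G
  hunterAt []       _       = Subset.⊥
  hunterAt (w ∷ _)  zero    = ⁅ w ⁆
  hunterAt (_ ∷ ws) (suc t) = hunterAt ws t

  hunterAt-one : ∀ ws → UsesHunters G 1 (hunterAt ws)
  hunterAt-one []       t       rewrite SubsetP.∣⊥∣≡0 n = z≤n
  hunterAt-one (w ∷ _)  zero    rewrite SubsetP.∣⁅x⁆∣≡1 w = ≤-refl
  hunterAt-one (_ ∷ ws) (suc t) = hunterAt-one ws t

  lookup-∈-hunterAt : ∀ ws (i : Fin (length ws)) → lookup ws i Subset.∈ hunterAt ws (toℕ i)
  lookup-∈-hunterAt (w ∷ _)  zero    = SubsetP.x∈⁅x⁆ w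
  lookup-∈-hunterAt (_ ∷ ws) (suc i) = lookup-∈-hunterAt ws i

  territory⊆after : ∀ ws t → t < length ws → Territory G (hunterAt ws) t ⊆ after U (take (suc t) ws)
  territory⊆after (w ∷ _) zero _ {v} v∉W =
    (proj₁ (noIsolated v) , tt , Adj-sym (proj₂ (noIsolated v))) , λ { refl → v∉W (SubsetP.x∈⁅x⁆ w) }
  territory⊆after ws (suc t) t<len {v} ((u , u∈T , a) , v∉W) =
    subst (λ xs → after U xs v) (sym take-suc)
      (subst (λ R → R v) (sym (ListP.foldl-++ shoot U (take (suc t) ws) [ w ]))
        ((u , territory⊆after ws t (≤-trans (s≤s (NP.n≤1+n t)) t<len) u∈T , a) , λ { refl → v∉W w∈W }))
    where
    i : Fin (length ws)
    i = fromℕ< t<len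
    w : Fin n
    w = lookup ws i
    w∈W : w Subset.∈ hunterAt ws (suc t)
    w∈W = subst (λ m → w Subset.∈ hunterAt ws m) (FP.toℕ-fromℕ< t<len) (lookup-∈-hunterAt ws i)
    take-suc : take (suc (suc t)) ws ≡ take (suc t) ws ∷ʳ w
    take-suc = subst (λ m → take (suc m) ws ≡ take m ws ∷ʳ w) (FP.toℕ-fromℕ< t<len) (ListP.take-suc ws i)

  clears⇒h≤1 : ∀ ws → Clears U ws → HuntingNumber≤ G 1
  clears⇒h≤1 ws clear = hunterAt ws , (pred (length ws) , caught ws clear) , hunterAt-one ws
    where
    caught : ∀ ws → Clears U ws → ∀ v → ¬ Territory G (hunterAt ws) (pred (length ws)) v
    caught []        clear v _   = clear v tt
    caught (w ∷ ws') clear v v∈T = clear v (subst (λ xs → after U xs v) (ListP.take-all _ (w ∷ ws') ≤-refl)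
                                      (territory⊆after (w ∷ ws') (length ws') ≤-refl v∈T))

Forbidden : ∀ {n} → Graph n → Set
Forbidden G = ContainsCycle G ⊎ ContainsLoopedPath G ⊎ ContainsPattern G 10 H1
              ⊎ ContainsPattern G 9 H2 ⊎ ContainsPattern G 8 H3 ⊎ ContainsPattern G 7 H4

PatternAdj : ∀ {m} → List (Fin m × Fin m) → Fin m → Fin m → Set
PatternAdj es j i = (j , i) ∈ es ⊎ (i , j) ∈ es

patternAdj? : ∀ {m} es j i → Dec (PatternAdj {m} es j i)
patternAdj? {m} es j i = ((j , i) ∈?ₑ es) ⊎-dec ((i , j) ∈?ₑ es)
  where
  _∈?ₑ_ : ∀ (e : Fin m × Fin m) es → Dec (e ∈ es)
  _∈?ₑ_ = _∈?_ (×P.≡-dec F._≟_ F._≟_)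

-- The rabbit can always move from a refuge Z into some refuge avoiding the next shot.
SafeFamily : ∀ {m} → List (Fin m × Fin m) → List (List (Fin m)) → Set
SafeFamily {m} es zs =
  All (λ Z → ∃ (_∈ Z)) zs ×
  (∀ w → Any (w ∉_) zs) ×
  All (λ Z → ∀ w → Any (All (λ i → i ≢ w × Any (λ j → PatternAdj es j i) Z)) zs) zs

safeFamily? : ∀ {m} es zs → Dec (SafeFamily {m} es zs)
safeFamily? {m} es zs =
  All.all? nonempty? zs ×-dec
  FP.all? (λ w → Any.any? (λ Z → ¬? (w ∈?ᶠ Z)) zs) ×-dec
  All.all? (λ Z → FP.all? λ w →
    Any.any? (All.all? λ i → ¬? (i F.≟ w) ×-dec Any.any? (λ j → patternAdj? es j i) Z) zs) zs
  where
  _∈?ᶠ_ : ∀ (w : Fin m) Z → Dec (w ∈ Z)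
  _∈?ᶠ_ = _∈?_ F._≟_
  nonempty? : ∀ {A : Set} (xs : List A) → Dec (∃ (_∈ xs))
  nonempty? []      = no λ ()
  nonempty? (x ∷ _) = yes (x , here refl)

module Evasion {n : ℕ} (G : Graph n) where
  open Graphs G

  -- A rabbit strategy inside the subgraph f, against a hunter shooting its vertex h (when the real
  -- hunter misses the subgraph, any h is a harmless overestimate).
  record Refuges {m : ℕ} (f : Fin m → Fin n) : Set₁ where
    field
      Refuge    : Set
      _∋_       : Refuge → Fin m → Set
      inhabited : ∀ Z → ∃ (Z ∋_)
      start     : ∀ h → ∃[ Z ] (∀ {i} → Z ∋ i → i ≢ h)
      next      : ∀ Z h → ∃[ Z' ] (∀ {i} → Z' ∋ i → i ≢ h × ∃[ j ] (Z ∋ j × Adj G (f j) (f i)))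

  refuges⇒¬h≤1 : ∀ {m} {f : Fin (suc m) → Fin n} → Injective _≡_ _≡_ f → Refuges f → ¬ HuntingNumber≤ G 1
  refuges⇒¬h≤1 {m} {f} f-inj refuges (W , (T , caught) , one) =
    let (Z , Z⊆T) = survives T ; (i , Z∋i) = inhabited Z in caught (f i) (Z⊆T Z∋i)
    where
    open Refuges refuges
    shot : ℕ → Fin (suc m)
    shot t with FP.any? (λ j → f j SubsetP.∈? W t)
    ... | yes (j , _) = j
    ... | no _        = zero
    shot-hit : ∀ t {i} → f i Subset.∈ W t → i ≡ shot t
    shot-hit t {i} fi∈W with FP.any? (λ j → f j SubsetP.∈? W t)
    ... | yes (j , fj∈W) = f-inj (∣p∣≤1⇒∈-unique (one t) fi∈W fj∈W)
    ... | no none        = ⊥-elim (none (i , fi∈W))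
    survives : ∀ t → ∃[ Z ] (∀ {i} → Z ∋ i → Territory G W t (f i))
    survives zero =
      let (Z , avoid) = start (shot 0) in Z , λ Z∋i fi∈W → avoid Z∋i (shot-hit 0 fi∈W)
    survives (suc t) =
      let (Z , Z⊆T) = survives t ; (Z' , step) = next Z (shot (suc t)) in
      Z' , λ Z'∋i → let (avoid , j , Z∋j , a) = step Z'∋i in
                    (f j , Z⊆T Z∋j , a) , λ fi∈W → avoid (shot-hit (suc t) fi∈W)

  MinDegree2 : ∀ {m} → (Fin m → Fin n) → Set
  MinDegree2 f = ∀ i → ∃₂ λ j j' → j ≢ j' × Adj G (f j) (f i) × Adj G (f j') (f i)

  -- The rabbit may be anywhere but at the vertex just shot.
  minDegree2⇒refuges : ∀ {m} {f : Fin m → Fin n} → MinDegree2 f → Refuges f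
  minDegree2⇒refuges {m} {f} deg2 = record
    { Refuge = Fin m ; _∋_ = λ r i → i ≢ r ; inhabited = λ r → let (j , j≢r , _) = other r r in j , j≢r
    ; start = λ h → h , λ i≢h → i≢h ; next = λ r h → h , λ i≢h → i≢h , other r _ }
    where
    other : ∀ r i → ∃[ j ] (j ≢ r × Adj G (f j) (f i))
    other r i with deg2 i
    ... | (j , j' , j≢j' , a , a') with j F.≟ r
    ... | yes refl = j' , (λ j'≡j → j≢j' (sym j'≡j)) , a'
    ... | no j≢r   = j , j≢r , a

  path-minDegree2 : ∀ k (f : Fin (suc (suc k)) → Fin n) →
    (∀ (i : Fin (suc k)) → Adj G (f (inject₁ i)) (f (suc i))) →
    ∀ s → s ≢ suc zero → Adj G (f s) (f zero) →
    ∀ e → e ≢ inject₁ (fromℕ k) → Adj G (f e) (f (fromℕ (suc k))) →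
    MinDegree2 f
  path-minDegree2 k f path s s≢1 s~first e e≢ e~last zero = s , suc zero , s≢1 , s~first , Adj-sym (path zero)
  path-minDegree2 k f path s s≢1 s~first e e≢ e~last (suc i) with lastOrInner i
  ... | last     = e , inject₁ (fromℕ k) , e≢ , e~last , path (fromℕ k)
  ... | inner i' = inject₁ (inject₁ i') , suc (suc i') , apart , path (inject₁ i') , Adj-sym (path (suc i'))
    where
    apart : inject₁ (inject₁ i') ≢ suc (suc i')
    apart eq = NP.m≢1+n+m (toℕ i') {1}
      (trans (sym (trans (FP.toℕ-inject₁ (inject₁ i')) (FP.toℕ-inject₁ i'))) (cong toℕ eq))

  cycle⇒¬h≤1 : ContainsCycle G → ¬ HuntingNumber≤ G 1
  cycle⇒¬h≤1 (suc (suc k) , s≤s (s≤s _) , f , f-inj , path , closing) =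
    refuges⇒¬h≤1 f-inj (minDegree2⇒refuges
      (path-minDegree2 (suc k) f path (fromℕ (suc (suc k))) (λ ()) closing zero (λ ()) (Adj-sym closing)))

  loopedPath⇒¬h≤1 : ContainsLoopedPath G → ¬ HuntingNumber≤ G 1
  loopedPath⇒¬h≤1 (k , f , f-inj , path , loop₀ , loop₁) =
    refuges⇒¬h≤1 f-inj (minDegree2⇒refuges
      (path-minDegree2 k f path zero (λ ()) loop₀ (fromℕ (suc k)) FP.fromℕ≢inject₁ loop₁))

  safeFamily⇒refuges : ∀ {m} {f : Fin m → Fin n} es zs →
    All (λ { (i , j) → Adj G (f i) (f j) }) es → SafeFamily es zs → Refuges f
  safeFamily⇒refuges {m} {f} es zs edges (inhabited , avoiding , moves) = record
    { Refuge = ∃ (_∈ zs) ; _∋_ = λ Z i → i ∈ proj₁ Z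
    ; inhabited = λ (_ , Z∈zs) → All.lookup inhabited Z∈zs
    ; start = λ h → let (Z , Z∈zs , h∉Z) = find (avoiding h) in (Z , Z∈zs) , λ { i∈Z refl → h∉Z i∈Z }
    ; next = λ (Z , Z∈zs) h → let (Z' , Z'∈zs , safe) = find (All.lookup moves Z∈zs h) in
        (Z' , Z'∈zs) , λ i∈Z' → let (i≢h , adjacent) = All.lookup safe i∈Z' ; (j , j∈Z , j~i) = find adjacent in
                                  i≢h , j , j∈Z , sound j~i }
    where
    sound : ∀ {j i} → PatternAdj es j i → Adj G (f j) (f i)
    sound (inj₁ ji∈es) = All.lookup edges ji∈es
    sound (inj₂ ij∈es) = Adj-sym (All.lookup edges ij∈es)

  pattern⇒¬h≤1 : ∀ {m} (es : List (Fin (suc m) × Fin (suc m))) zs → True (safeFamily? es zs) →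
                 ContainsPattern G (suc m) es → ¬ HuntingNumber≤ G 1
  pattern⇒¬h≤1 es zs safe (f , f-inj , edges) =
    refuges⇒¬h≤1 f-inj (safeFamily⇒refuges es zs edges (toWitness safe))

-- Refuge families for H1, …, H4; the `_` arguments in OnlyIf check by evaluation that they are safe.
refugesH1 : List (List (Fin 10))
refugesH1 =
  (# 5 ∷ # 8 ∷ []) ∷ (# 0 ∷ []) ∷ (# 1 ∷ # 6 ∷ []) ∷ (# 1 ∷ # 7 ∷ []) ∷ (# 2 ∷ # 5 ∷ []) ∷ (# 2 ∷ # 8 ∷ []) ∷
  (# 1 ∷ # 9 ∷ []) ∷ (# 6 ∷ # 7 ∷ []) ∷ (# 3 ∷ # 7 ∷ []) ∷ (# 4 ∷ # 7 ∷ []) ∷ (# 4 ∷ # 9 ∷ []) ∷ (# 1 ∷ # 4 ∷ []) ∷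
  (# 3 ∷ # 4 ∷ []) ∷ []

refugesH2 : List (List (Fin 9))
refugesH2 =
  (# 7 ∷ []) ∷ (# 0 ∷ []) ∷ (# 8 ∷ []) ∷ (# 1 ∷ # 6 ∷ []) ∷ (# 2 ∷ # 5 ∷ []) ∷ (# 1 ∷ # 4 ∷ []) ∷
  (# 3 ∷ # 4 ∷ []) ∷ []

refugesH3 : List (List (Fin 8))
refugesH3 = (# 7 ∷ []) ∷ (# 0 ∷ []) ∷ (# 1 ∷ # 6 ∷ []) ∷ (# 1 ∷ # 4 ∷ []) ∷ (# 2 ∷ # 5 ∷ []) ∷ (# 3 ∷ # 4 ∷ []) ∷ []

refugesH4 : List (List (Fin 7))
refugesH4 = (# 0 ∷ []) ∷ (# 1 ∷ # 6 ∷ []) ∷ (# 1 ∷ # 4 ∷ []) ∷ (# 2 ∷ # 5 ∷ []) ∷ (# 3 ∷ # 4 ∷ []) ∷ []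

module OnlyIf {n : ℕ} (G : Graph n) where
  open Evasion G

  h≤1⇒noForbidden : HuntingNumber≤ G 1 → ¬ Forbidden G
  h≤1⇒noForbidden h (inj₁ c)                               = cycle⇒¬h≤1 c h
  h≤1⇒noForbidden h (inj₂ (inj₁ p))                        = loopedPath⇒¬h≤1 p h
  h≤1⇒noForbidden h (inj₂ (inj₂ (inj₁ p)))                 = pattern⇒¬h≤1 H1 refugesH1 _ p h
  h≤1⇒noForbidden h (inj₂ (inj₂ (inj₂ (inj₁ p))))          = pattern⇒¬h≤1 H2 refugesH2 _ p h
  h≤1⇒noForbidden h (inj₂ (inj₂ (inj₂ (inj₂ (inj₁ p)))))   = pattern⇒¬h≤1 H3 refugesH3 _ p h
  h≤1⇒noForbidden h (inj₂ (inj₂ (inj₂ (inj₂ (inj₂ p)))))   = pattern⇒¬h≤1 H4 refugesH4 _ p h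

module Lobsters {n : ℕ} (G : Graph n) where
  open Graphs G
  open Shooting G

  -- How an edge uv lies in a lobster, where u has position pu, depth du and parent au, and likewise v.
  data EdgeKind (u v : Fin n) (pu du : ℕ) (au : Fin n) (pv dv : ℕ) (av : Fin n) : Set where
    spine-next : du ≡ 0 → dv ≡ 0 → pv ≡ suc pu → EdgeKind u v pu du au pv dv av
    spine-prev : du ≡ 0 → dv ≡ 0 → pu ≡ suc pv → EdgeKind u v pu du au pv dv av
    spine-hair : du ≡ 0 → dv ≡ 1 → pv ≡ pu → EdgeKind u v pu du au pv dv av
    hair-spine : du ≡ 1 → dv ≡ 0 → pv ≡ pu → EdgeKind u v pu du au pv dv av
    hair-tip   : du ≡ 1 → dv ≡ 2 → av ≡ u → pv ≡ pu → EdgeKind u v pu du au pv dv av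
    tip-hair   : du ≡ 2 → dv ≡ 1 → au ≡ v → pv ≡ pu → EdgeKind u v pu du au pv dv av

  parity : ℕ → Bool
  parity zero    = false
  parity (suc k) = not (parity k)

  level-step : ∀ {u v pu du au pv dv av} → EdgeKind u v pu du au pv dv av →
               pv + dv ≡ suc (pu + du) ⊎ pu + du ≡ suc (pv + dv)
  level-step (spine-next refl refl p)    = inj₁ (cong (_+ 0) p)
  level-step (spine-prev refl refl p)    = inj₂ (cong (_+ 0) p)
  level-step (spine-hair refl refl refl) = inj₁ (NP.+-suc _ 0)
  level-step (hair-spine refl refl refl) = inj₂ (NP.+-suc _ 0)
  level-step (hair-tip refl refl _ refl) = inj₁ (NP.+-suc _ 1)
  level-step (tip-hair refl refl _ refl) = inj₂ (NP.+-suc _ 1)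

  parity-flips : ∀ {u v pu du au pv dv av} → EdgeKind u v pu du au pv dv av → parity (pu + du) ≢ parity (pv + dv)
  parity-flips kind with level-step kind
  ... | inj₁ e = λ same → BoolP.not-¬ refl (trans same (cong parity e))
  ... | inj₂ e = λ same → BoolP.not-¬ refl (trans (sym same) (cong parity e))

  -- Each vertex of Body is on the spine (depth 0), a hair adjacent to the spine (depth 1) or a tip
  -- adjacent to its parent hair (depth 2); pos is the index of the spine vertex it hangs from.
  record Lobster : Set₁ where
    field
      Body       : Region
      L          : ℕ
      spine      : ℕ → Fin n
      pos dep    : Fin n → ℕ
      par        : Fin n → Fin n
      colour     : Fin n → Bool
      hairs      : ℕ → List (Fin n)
      pos≤L      : ∀ {v} → Body v → pos v ≤ L
      depth      : ∀ {v} → Body v → dep v ≡ 0 ⊎ dep v ≡ 1 ⊎ dep v ≡ 2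
      spine-pos  : ∀ {v} → Body v → dep v ≡ 0 → v ≡ spine (pos v)
      spine-body : ∀ {i} → i ≤ L → Body (spine i) × dep (spine i) ≡ 0 × pos (spine i) ≡ i
      spine-adj  : ∀ {i} → suc i ≤ L → Adj G (spine i) (spine (suc i))
      hair-∈     : ∀ {v} → Body v → dep v ≡ 1 → v ∈ hairs (pos v)
      hairs-body : ∀ {i r} → i ≤ L → r ∈ hairs i → Body r × dep r ≡ 1 × pos r ≡ i
      hair-adj   : ∀ {v} → Body v → dep v ≡ 1 → Adj G v (spine (pos v))
      tip-parent : ∀ {v} → Body v → dep v ≡ 2 → Body (par v) × dep (par v) ≡ 1 × pos (par v) ≡ pos v
      edge       : ∀ {u v} → Body u → Adj G u v → u ≢ v →
                   Body v × EdgeKind u v (pos u) (dep u) (par u) (pos v) (dep v) (par v)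
      proper     : ∀ {u v} → Body u → Adj G u v → u ≢ v → colour u ≢ colour v

  mirror : Lobster → Lobster
  mirror Λ = record
    { Body = Body ; L = L ; spine = λ i → spine (L ∸ i) ; pos = λ v → L ∸ pos v ; dep = dep ; par = par
    ; colour = colour ; hairs = λ i → hairs (L ∸ i)
    ; pos≤L      = λ {v} _ → NP.m∸n≤m L (pos v)
    ; depth      = depth
    ; spine-pos  = λ v∈B d → trans (spine-pos v∈B d) (cong spine (sym (NP.m∸[m∸n]≡n (pos≤L v∈B))))
    ; spine-body = λ {i} i≤L → let (s∈B , d , p) = spine-body (NP.m∸n≤m L i) in
                           s∈B , d , trans (cong (L ∸_) p) (NP.m∸[m∸n]≡n i≤L)
    ; spine-adj  = reverse-path spine spine-adj
    ; hair-∈     = λ {v} v∈B d → subst (λ j → v ∈ hairs j) (sym (NP.m∸[m∸n]≡n (pos≤L v∈B))) (hair-∈ v∈B d)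
    ; hairs-body = λ {i} i≤L r∈ → let (r∈B , d , p) = hairs-body (NP.m∸n≤m L i) r∈ in
                              r∈B , d , trans (cong (L ∸_) p) (NP.m∸[m∸n]≡n i≤L)
    ; hair-adj   = λ {v} v∈B d → subst (λ j → Adj G v (spine j)) (sym (NP.m∸[m∸n]≡n (pos≤L v∈B))) (hair-adj v∈B d)
    ; tip-parent = λ v∈B d → let (p∈B , d' , p) = tip-parent v∈B d in p∈B , d' , cong (L ∸_) p
    ; edge       = λ u∈B a u≢v → let (v∈B , kind) = edge u∈B a u≢v in v∈B , reflect u∈B v∈B kind
    ; proper     = proper }
    where
    open Lobster Λ
    down : ∀ {w a} → Body w → pos w ≡ suc a → L ∸ a ≡ suc (L ∸ pos w)
    down {a = a} w∈B p = subst (λ b → L ∸ a ≡ suc (L ∸ b)) (sym p) (∸-suc (subst (_≤ L) p (pos≤L w∈B)))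
    reflect : ∀ {u v} → Body u → Body v → EdgeKind u v (pos u) (dep u) (par u) (pos v) (dep v) (par v) →
              EdgeKind u v (L ∸ pos u) (dep u) (par u) (L ∸ pos v) (dep v) (par v)
    reflect u∈B v∈B (spine-next du dv p) = spine-prev du dv (down v∈B p)
    reflect u∈B v∈B (spine-prev du dv p) = spine-next du dv (down u∈B p)
    reflect u∈B v∈B (spine-hair du dv p) = spine-hair du dv (cong (L ∸_) p)
    reflect u∈B v∈B (hair-spine du dv p) = hair-spine du dv (cong (L ∸_) p)
    reflect u∈B v∈B (hair-tip du dv e p) = hair-tip du dv e (cong (L ∸_) p)
    reflect u∈B v∈B (tip-hair du dv e p) = tip-hair du dv e (cong (L ∸_) p)

  module Sweep (Λ : Lobster) where
    open Lobster Λ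

    body-closed : Closed Body
    body-closed {u} {v} u∈B a with u F.≟ v
    ... | yes refl = u∈B
    ... | no u≢v   = proj₁ (edge u∈B a u≢v)

    data Stage : Set where
      atSpine : ℕ → List (Fin n) → Stage
      atHair  : ℕ → Fin n → List (Fin n) → Stage

    target : Stage → Fin n
    target (atSpine i _)  = spine i
    target (atHair _ r _) = r

    -- In atSpine i rs and atHair i r rs, the hairs rs of spine i are still to be visited.
    Valid : Stage → Set
    Valid (atSpine i rs)  = i ≤ L × All (_∈ hairs i) rs
    Valid (atHair i r rs) = i ≤ L × All (_∈ hairs i) (r ∷ rs)

    data _⟶_ : Stage → Stage → Set where
      enter   : ∀ {i r rs} → atSpine i (r ∷ rs) ⟶ atHair i r rs
      leave   : ∀ {i r rs} → atHair i r rs ⟶ atSpine i rs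
      advance : ∀ {i} → suc i ≤ L → atSpine i [] ⟶ atSpine (suc i) (hairs (suc i))

    -- v lies beyond the part of the lobster swept by stage σ.
    Ahead : Stage → Region
    Ahead (atSpine i rs)  v = i < pos v ⊎ (pos v ≡ i × dep v ≡ 2 × par v ∈ rs)
    Ahead (atHair i _ rs) v = i < pos v ⊎ (pos v ≡ i × dep v ≡ 1 × v ∈ rs)

    InPhase : Stage → Region
    InPhase σ v = colour v ≡ colour (target σ)

    dep-spine : ∀ {i} → i ≤ L → dep (spine i) ≡ 0
    dep-spine i≤L = proj₁ (proj₂ (spine-body i≤L))

    pos-spine : ∀ {i} → i ≤ L → pos (spine i) ≡ i
    pos-spine i≤L = proj₂ (proj₂ (spine-body i≤L))

    hair-colour : ∀ {i r} → i ≤ L → r ∈ hairs i → colour r ≢ colour (spine i)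
    hair-colour i≤L r∈ with hairs-body i≤L r∈
    ... | r∈B , d , refl = proper r∈B (hair-adj r∈B d) λ r≡s →
          contradiction (trans (sym d) (trans (cong dep r≡s) (dep-spine i≤L))) λ ()

    spine-colour : ∀ {i} → suc i ≤ L → colour (spine i) ≢ colour (spine (suc i))
    spine-colour {i} si≤L = proper (proj₁ (spine-body i≤L)) (spine-adj si≤L) λ s≡s' →
      NP.1+n≢n (trans (sym (pos-spine si≤L)) (trans (cong pos (sym s≡s')) (pos-spine i≤L)))
      where
      i≤L : i ≤ L
      i≤L = NP.≤-trans (NP.n≤1+n i) si≤L

    target-colour : ∀ {σ σ'} → σ ⟶ σ' → Valid σ → Valid σ' → colour (target σ) ≢ colour (target σ')
    target-colour enter         _               (i≤L , r∈ ∷ _) e = hair-colour i≤L r∈ (sym e)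
    target-colour leave         (i≤L , r∈ ∷ _)  _              = hair-colour i≤L r∈
    target-colour (advance si≤L) _              _              = spine-colour si≤L

    in-phase-at : ∀ {y j} → j ≤ L → Body y → y ≢ spine j → colour y ≡ colour (spine j) → pos y ≡ j →
                  dep y ≡ 2 × par y ∈ hairs j
    in-phase-at _ y∈B y≢s same refl with depth y∈B
    ... | inj₁ d0        = ⊥-elim (y≢s (spine-pos y∈B d0))
    ... | inj₂ (inj₁ d1) = ⊥-elim (proper y∈B (hair-adj y∈B d1) y≢s same)
    ... | inj₂ (inj₂ d2) = let (p∈B , d , p) = tip-parent y∈B d2 in
                           d2 , subst (λ j → par _ ∈ hairs j) p (hair-∈ p∈B d)

    descend : ∀ {x y} → Body x → Adj G x y → x ≢ y → pos y < pos x → dep y ≡ 0 × pos x ≡ suc (pos y)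
    descend {x} x∈B a x≢y py<px with proj₂ (edge x∈B a x≢y)
    ... | spine-next _ _ p   = ⊥-elim (NP.<-asym py<px (subst (pos x <_) (sym p) (NP.n<1+n (pos x))))
    ... | spine-prev _ dy p  = dy , p
    ... | spine-hair _ _ p   = ⊥-elim (NP.<-irrefl p py<px)
    ... | hair-spine _ _ p   = ⊥-elim (NP.<-irrefl p py<px)
    ... | hair-tip _ _ _ p   = ⊥-elim (NP.<-irrefl p py<px)
    ... | tip-hair _ _ _ p   = ⊥-elim (NP.<-irrefl p py<px)

    -- Only spine edges lower the position, and only by one.
    retreat : ∀ {x y i} → Body x → Adj G x y → x ≢ y → i < pos x → pos y ≤ i → y ≡ spine i
    retreat x∈B a x≢y i<px py≤i with descend x∈B a x≢y (NP.≤-<-trans py≤i i<px)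
    ... | dy , px≡ = trans (spine-pos (proj₁ (edge x∈B a x≢y)) dy)
                           (cong spine (NP.≤-antisym py≤i (NP.≤-pred (subst (_<_ _) px≡ i<px))))

    tip-edge : ∀ {x y} → Body x → dep x ≡ 2 → Adj G x y → x ≢ y → par x ≡ y
    tip-edge x∈B d a x≢y with proj₂ (edge x∈B a x≢y)
    ... | spine-next dx _ _  = contradiction (trans (sym d) dx) λ ()
    ... | spine-prev dx _ _  = contradiction (trans (sym d) dx) λ ()
    ... | spine-hair dx _ _  = contradiction (trans (sym d) dx) λ ()
    ... | hair-spine dx _ _  = contradiction (trans (sym d) dx) λ ()
    ... | hair-tip dx _ _ _  = contradiction (trans (sym d) dx) λ ()
    ... | tip-hair _ _ e _   = e

    hair-edge : ∀ {x y} → Body x → dep x ≡ 1 → Adj G x y → x ≢ y →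
                (dep y ≡ 0 × pos y ≡ pos x) ⊎ (dep y ≡ 2 × par y ≡ x)
    hair-edge x∈B d a x≢y with proj₂ (edge x∈B a x≢y)
    ... | spine-next dx _ _  = contradiction (trans (sym d) dx) λ ()
    ... | spine-prev dx _ _  = contradiction (trans (sym d) dx) λ ()
    ... | spine-hair dx _ _  = contradiction (trans (sym d) dx) λ ()
    ... | hair-spine _ dy p  = inj₁ (dy , p)
    ... | hair-tip _ dy e _  = inj₂ (dy , e)
    ... | tip-hair dx _ _ _  = contradiction (trans (sym d) dx) λ ()

    ahead-step : ∀ {σ σ' x y} → σ ⟶ σ' → Valid σ → Valid σ' → Body x → Ahead σ x →
                 Adj G x y → x ≢ y → y ≢ target σ' → InPhase σ' y → Ahead σ' y
    ahead-step {y = y} enter _ (i≤L , r∈ ∷ _) x∈B (inj₁ i<px) a x≢y _ same with _ <? pos y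
    ... | yes i<py = inj₁ i<py
    ... | no  i≮py =
      ⊥-elim (hair-colour i≤L r∈ (trans (sym same) (cong colour (retreat x∈B a x≢y i<px (NP.≮⇒≥ i≮py)))))
    ahead-step enter _ _ x∈B (inj₂ (refl , d2 , p∈)) a x≢y y≢r _ with tip-edge x∈B d2 a x≢y
    ... | refl with p∈
    ...   | here p≡r = ⊥-elim (y≢r p≡r)
    ...   | there p∈rs = let (_ , d1 , p) = tip-parent x∈B d2 in inj₂ (p , d1 , p∈rs)
    ahead-step {y = y} leave _ _ x∈B (inj₁ i<px) a x≢y y≢s _ with _ <? pos y
    ... | yes i<py = inj₁ i<py
    ... | no  i≮py = ⊥-elim (y≢s (retreat x∈B a x≢y i<px (NP.≮⇒≥ i≮py)))
    ahead-step leave _ _ x∈B (inj₂ (refl , d1 , x∈rs)) a x≢y y≢s _ with hair-edge x∈B d1 a x≢y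
    ... | inj₁ (d0 , p)      = ⊥-elim (y≢s (trans (spine-pos (proj₁ (edge x∈B a x≢y)) d0) (cong spine p)))
    ... | inj₂ (d2 , refl)   = let (_ , _ , p) = tip-parent (proj₁ (edge x∈B a x≢y)) d2 in inj₂ (sym p , d2 , x∈rs)
    ahead-step {y = y} (advance {i} si≤L) _ _ x∈B (inj₁ i<px) a x≢y y≢s same with suc i <? pos y
    ... | yes si<py = inj₁ si<py
    ... | no  si≮py with pos y NP.≟ suc i
    ...   | yes py≡si = inj₂ (py≡si , in-phase-at si≤L (proj₁ (edge x∈B a x≢y)) y≢s same py≡si)
    ...   | no  py≢si = ⊥-elim (spine-colour si≤L (trans (cong colour (sym y≡s)) same))
      where
      y≡s : y ≡ spine i
      y≡s = retreat x∈B a x≢y i<px (NP.≤-pred (NP.≤∧≢⇒< (NP.≮⇒≥ si≮py) py≢si))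

    phase-step : ∀ {σ σ' x y} → σ ⟶ σ' → Valid σ → Valid σ' → Body x → Adj G x y → x ≢ y →
                 InPhase σ x → InPhase σ' y
    phase-step t vσ vσ' x∈B a x≢y same =
      ≢∧≢⇒≡ (proper x∈B a x≢y) λ e → target-colour t vσ vσ' (trans (sym same) e)

    phase-step⁻ : ∀ {σ σ' x y} → σ ⟶ σ' → Valid σ → Valid σ' → Body x → Adj G x y → x ≢ y →
                  InPhase σ' y → InPhase σ x
    phase-step⁻ t vσ vσ' x∈B a x≢y same =
      ≢∧≢⇒≡ (≢-sym (proper x∈B a x≢y)) λ e → target-colour t vσ vσ' (trans (sym e) same)

    start-ahead : ∀ {v} → Body v → v ≢ spine 0 → InPhase (atSpine 0 (hairs 0)) v → Ahead (atSpine 0 (hairs 0)) v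
    start-ahead {v} v∈B v≢s same with 0 <? pos v
    ... | yes 0<pv = inj₁ 0<pv
    ... | no  0≮pv = let pv≡0 = NP.n≤0⇒n≡0 (NP.≮⇒≥ 0≮pv) in inj₂ (pv≡0 , in-phase-at z≤n v∈B v≢s same pv≡0)

    end-not-ahead : ∀ {v} → Body v → ¬ Ahead (atSpine L []) v
    end-not-ahead v∈B (inj₁ L<pv) = NP.<⇒≱ L<pv (pos≤L v∈B)

    Preserved : (Stage → Region) → Set
    Preserved I = ∀ {σ σ' x y} → σ ⟶ σ' → Valid σ → Valid σ' → I σ x → Adj G x y → y ≢ target σ' → I σ' y

    -- During the first pass an in-phase rabbit is still ahead, so at its end the rabbit is out of phase.
    FirstPass : Stage → Region
    FirstPass σ v = Body v × v ≢ target σ × (InPhase σ v → Ahead σ v)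

    SecondPass : Stage → Region
    SecondPass σ v = Body v × v ≢ target σ × InPhase σ v × Ahead σ v

    firstPass-preserved : (∀ {u} → Body u → Adj G u u → u ≡ spine L) → Preserved FirstPass
    firstPass-preserved loops {σ' = σ'} {x} {y} t vσ vσ' (x∈B , _ , ahead) a y≢t with x F.≟ y
    ... | yes refl = x∈B , y≢t , end-ahead σ' vσ' (loops x∈B a) y≢t
      where
      end-ahead : ∀ σ' → Valid σ' → x ≡ spine L → x ≢ target σ' → InPhase σ' x → Ahead σ' x
      end-ahead (atSpine j _) (j≤L , _) refl x≢t _ with NP.m≤n⇒m<n∨m≡n j≤L
      ... | inj₁ j<L = inj₁ (subst (j <_) (sym (pos-spine ≤-refl)) j<L)
      ... | inj₂ refl = ⊥-elim (x≢t refl)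
      end-ahead (atHair j r _) (j≤L , r∈ ∷ _) refl _ same with NP.m≤n⇒m<n∨m≡n j≤L
      ... | inj₁ j<L = inj₁ (subst (j <_) (sym (pos-spine ≤-refl)) j<L)
      ... | inj₂ refl = ⊥-elim (hair-colour j≤L r∈ (sym same))
    ... | no x≢y = proj₁ (edge x∈B a x≢y) , y≢t ,
                   λ same → ahead-step t vσ vσ' x∈B (ahead (phase-step⁻ t vσ vσ' x∈B a x≢y same)) a x≢y y≢t same

    secondPass-preserved : (∀ {u} → Body u → Adj G u u → u ≡ spine 0) → Preserved SecondPass
    secondPass-preserved loops {σ} {x = x} {y} t vσ vσ' (x∈B , _ , same , ahead) a y≢t with x F.≟ y
    ... | yes refl = ⊥-elim (start-behind σ (loops x∈B a) ahead)
      where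
      start-behind : ∀ σ → x ≡ spine 0 → ¬ Ahead σ x
      start-behind σ refl = behind σ (pos-spine z≤n) (dep-spine z≤n)
        where
        behind : ∀ σ → pos x ≡ 0 → dep x ≡ 0 → ¬ Ahead σ x
        behind (atSpine _ _)  p _ (inj₁ i<px)         = NP.n≮0 (subst (_ <_) p i<px)
        behind (atHair _ _ _) p _ (inj₁ i<px)         = NP.n≮0 (subst (_ <_) p i<px)
        behind (atSpine _ _)  _ d (inj₂ (_ , d2 , _)) = contradiction (trans (sym d2) d) λ ()
        behind (atHair _ _ _) _ d (inj₂ (_ , d1 , _)) = contradiction (trans (sym d1) d) λ ()
    ... | no x≢y = proj₁ (edge x∈B a x≢y) , y≢t , phase-step t vσ vσ' x∈B a x≢y same ,
                   ahead-step t vσ vσ' x∈B ahead a x≢y y≢t (phase-step t vσ vσ' x∈B a x≢y same)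

    visit : ℕ → List (Fin n) → List Stage
    visit i []       = []
    visit i (r ∷ rs) = atHair i r rs ∷ atSpine i rs ∷ visit i rs

    block : ℕ → List Stage
    block i = atSpine i (hairs i) ∷ visit i (hairs i)

    sweep : ℕ → List Stage
    sweep zero    = block 0
    sweep (suc k) = sweep k ++ block (suc k)

    shots : ℕ → List (Fin n)
    shots k = map target (sweep k)

    module Run (I : Stage → Region) (preserved : Preserved I) where

      shoot-preserved : ∀ {σ σ' R} → σ ⟶ σ' → Valid σ → Valid σ' → R ⊆ I σ → shoot R (target σ') ⊆ I σ'
      shoot-preserved t vσ vσ' R⊆I ((u , u∈R , a) , v≢t) = preserved t vσ vσ' (R⊆I u∈R) a v≢t

      after-visit : ∀ {i} rs {R} → Valid (atSpine i rs) → R ⊆ I (atSpine i rs) →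
                    after R (map target (visit i rs)) ⊆ I (atSpine i [])
      after-visit []       _                 R⊆I = R⊆I
      after-visit (r ∷ rs) (i≤L , r∈ ∷ rs∈) R⊆I =
        after-visit rs (i≤L , rs∈)
          (shoot-preserved leave (i≤L , r∈ ∷ rs∈) (i≤L , rs∈)
            (shoot-preserved enter (i≤L , r∈ ∷ rs∈) (i≤L , r∈ ∷ rs∈) R⊆I))

      after-block : ∀ {i R} → i ≤ L → shoot R (spine i) ⊆ I (atSpine i (hairs i)) →
                    after R (map target (block i)) ⊆ I (atSpine i [])
      after-block {i} i≤L = after-visit (hairs i) (i≤L , All.tabulate (λ r∈ → r∈))

      after-sweep : ∀ k {R} → k ≤ L → shoot R (spine 0) ⊆ I (atSpine 0 (hairs 0)) →
                    after R (shots k) ⊆ I (atSpine k [])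
      after-sweep zero    _    start = after-block z≤n start
      after-sweep (suc k) {R} sk≤L start
        rewrite ListP.map-++ target (sweep k) (block (suc k))
              | ListP.foldl-++ shoot R (shots k) (map target (block (suc k))) =
        after-block sk≤L (shoot-preserved (advance sk≤L) (k≤L , []) (sk≤L , All.tabulate (λ r∈ → r∈))
                           (after-sweep k k≤L start))
        where
        k≤L : k ≤ L
        k≤L = NP.≤-trans (NP.n≤1+n k) sk≤L

  -- Sweep the mirrored lobster first: this leaves the rabbit out of phase with spine 0, and the second
  -- sweep, in phase with it, catches it. A loop at spine 0 is harmless at that turning point.
  lobster-cleared : (Λ : Lobster) → let open Lobster Λ in
    (∀ {u} → Body u → Adj G u u → u ≡ spine 0) → ∃[ ws ] Clears Body ws
  lobster-cleared Λ loops = Mirrored.shots L ++ Direct.shots L , cleared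
    where
    open Lobster Λ
    module Mirrored = Sweep (mirror Λ)
    module Direct = Sweep Λ
    L∸L≡0 : L ∸ L ≡ 0
    L∸L≡0 = NP.n∸n≡0 L
    module First = Mirrored.Run Mirrored.FirstPass
      (Mirrored.firstPass-preserved λ u∈B a → trans (loops u∈B a) (cong spine (sym L∸L≡0)))
    module Second = Direct.Run Direct.SecondPass (Direct.secondPass-preserved loops)

    first : after Body (Mirrored.shots L) ⊆ Mirrored.FirstPass (Mirrored.atSpine L [])
    first = First.after-sweep L ≤-refl λ ((u , u∈B , a) , v≢s) →
      let v∈B = Direct.body-closed u∈B a in v∈B , v≢s , Mirrored.start-ahead v∈B v≢s

    second : after (after Body (Mirrored.shots L)) (Direct.shots L) ⊆ Direct.SecondPass (Direct.atSpine L [])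
    second = Second.after-sweep L ≤-refl λ { {v} ((u , u∈F , a) , v≢s) →
      let (u∈B , u≢s , ahead) = first u∈F
          s≡s = cong spine L∸L≡0
          u≢v = λ { refl → u≢s (trans (loops u∈B a) (sym s≡s)) }
          out : colour u ≢ colour (spine 0)
          out e = Mirrored.end-not-ahead u∈B (ahead (trans e (cong colour (sym s≡s))))
          same = ≢∧≢⇒≡ (proper u∈B a u≢v) out
          v∈B = proj₁ (edge u∈B a u≢v)
      in v∈B , v≢s , same , Direct.start-ahead v∈B v≢s same }

    cleared : Clears Body (Mirrored.shots L ++ Direct.shots L)
    cleared v v∈after
      rewrite ListP.foldl-++ shoot Body (Mirrored.shots L) (Direct.shots L) =
      let (v∈B , _ , _ , ahead) = second v∈after in Direct.end-not-ahead v∈B ahead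

module Subgraphs {n : ℕ} (G : Graph n) where

  cycle-from-list : ∀ x ys → 2 ≤ length ys → Unique (x ∷ ys) → Linked (Adj G) (x ∷ ys) →
                    Adj G (last′ x ys) x → ContainsCycle G
  cycle-from-list x ys 2≤len u l close =
    length ys , 2≤len , lookup (x ∷ ys) , lookup-injective u , linked-lookup l ,
    subst (λ z → Adj G z x) (sym (lookup-last x ys)) close

  loopedPath-from-list : ∀ x ys → 1 ≤ length ys → Unique (x ∷ ys) → Linked (Adj G) (x ∷ ys) →
                         Adj G x x → Adj G (last′ x ys) (last′ x ys) → ContainsLoopedPath G
  loopedPath-from-list x (y ∷ ys) _ u l loop₀ loop₁ =
    length ys , lookup (x ∷ y ∷ ys) , lookup-injective u , linked-lookup l , loop₀ ,
    subst (λ z → Adj G z z) (sym (lookup-last x (y ∷ ys))) loop₁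

  pattern-from-list : ∀ {m} es (vs : List (Fin n)) (π : Fin m → Fin (length vs)) → Unique vs →
    True (injective? π) → All (λ { (i , j) → Adj G (lookup vs (π i)) (lookup vs (π j)) }) es →
    ContainsPattern G m es
  pattern-from-list es vs π u π-inj edges =
    (λ i → lookup vs (π i)) , (λ e → toWitness π-inj (lookup-injective u e)) , All.map (λ a → a) edges

module Spines {n : ℕ} (G : Graph n) where
  open Graphs G
  open Subgraphs G
  open Lobsters G

  record Spine : Set where
    field
      L         : ℕ
      spine     : ℕ → Fin n
      spine-inj : ∀ {i j} → i ≤ L → j ≤ L → spine i ≡ spine j → i ≡ j
      spine-adj : ∀ {i} → suc i ≤ L → Adj G (spine i) (spine (suc i))

  module Around (S : Spine) where
    open Spine S

    OnSpine : Region
    OnSpine v = ∃[ i ] (i ≤ L × spine i ≡ v)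

    OffSpine : Region
    OffSpine v = ¬ OnSpine v

    NearSpine : Region
    NearSpine v = ∃[ i ] (i ≤ L × Adj G v (spine i))

    Hair : Region
    Hair v = OffSpine v × NearSpine v

    OnHair : Region
    OnHair v = ∃[ r ] (Hair r × Adj G v r)

    Tip : Region
    Tip v = OffSpine v × ¬ NearSpine v × OnHair v

    Far : Region
    Far v = OffSpine v × ¬ NearSpine v × ¬ OnHair v

    onSpine? : Decidable OnSpine
    onSpine? v = Dec.map′ (λ (i , i<sL , e) → i , NP.≤-pred i<sL , e) (λ (i , i≤L , e) → i , s≤s i≤L , e)
                   (NP.anyUpTo? (λ i → spine i F.≟ v) (suc L))

    segment : ℕ → ℕ → List (Fin n)
    segment i m = applyUpTo (λ t → spine (t + i)) (suc m)

    segment-bound : ∀ {i m t} → m + i ≤ L → t < suc m → t + i ≤ L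
    segment-bound {i} m+i≤L t<sm = ≤-trans (NP.+-monoˡ-≤ i (NP.≤-pred t<sm)) m+i≤L

    segment-linked : ∀ i m → m + i ≤ L → Linked (Adj G) (segment i m)
    segment-linked i m m+i≤L =
      LinkedP.applyUpTo⁺₁ (λ t → spine (t + i)) (suc m) λ st<sm → spine-adj (segment-bound m+i≤L st<sm)

    spine-step : ∀ {i} m (t : Fin m) → m + i ≤ L → Adj G (spine (toℕ t + i)) (spine (suc (toℕ t) + i))
    spine-step {i} m t m+i≤L = spine-adj (≤-trans (NP.+-monoˡ-≤ i (FP.toℕ<n t)) m+i≤L)

    segment-++-unique : ∀ i m {cs} → m + i ≤ L → Unique cs → All OffSpine cs → Unique (segment i m ++ cs)
    segment-++-unique i m m+i≤L u off = UniqueP.++⁺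
      (UniqueP.applyUpTo⁺₁ (λ t → spine (t + i)) (suc m) λ {s} {t} s<t t<sm e →
        NP.<⇒≢ s<t (NP.+-cancelʳ-≡ i s t
          (spine-inj (segment-bound m+i≤L (NP.<-trans s<t t<sm)) (segment-bound m+i≤L t<sm) e)))
      u λ (v∈seg , v∈cs) → let (t , t<sm , v≡) = ∈-applyUpTo⁻ (λ t → spine (t + i)) v∈seg in
                            All.lookup off v∈cs (t + i , segment-bound m+i≤L t<sm , sym v≡)

    spine-then : ∀ {i j} cs → i ≤ j → j ≤ L → Unique cs → All OffSpine cs → Linked (Adj G) (spine j ∷ cs) →
      let ys = applyUpTo (λ t → spine (suc t + i)) (j ∸ i) ++ cs in
      Unique (spine i ∷ ys) × Linked (Adj G) (spine i ∷ ys) ×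
      last′ (spine i) ys ≡ last′ (spine j) cs × length ys ≡ length cs + (j ∸ i)
    spine-then {i} {j} cs i≤j j≤L u off l =
      segment-++-unique i m m+i≤L u off ,
      linked-++ (segment-linked i m m+i≤L) (subst (λ z → Linked (Adj G) (z ∷ cs)) (sym seg-last) l) ,
      trans (last′-++ (spine i) tail cs) (cong (λ z → last′ z cs) seg-last) ,
      trans (ListP.length-++ tail) (trans (cong (_+ length cs) (ListP.length-applyUpTo _ m)) (NP.+-comm m _))
      where
      m : ℕ
      m = j ∸ i
      m+i≡j : m + i ≡ j
      m+i≡j = NP.m∸n+n≡m i≤j
      m+i≤L : m + i ≤ L
      m+i≤L = subst (_≤ L) (sym m+i≡j) j≤L
      tail : List (Fin n)
      tail = applyUpTo (λ t → spine (suc t + i)) m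
      seg-last : last′ (spine i) tail ≡ spine j
      seg-last = trans (last′-applyUpTo (λ t → spine (t + i)) m) (cong spine m+i≡j)

    spine-cycle : ∀ {i j} cs → i ≤ j → j ≤ L → Unique cs → All OffSpine cs → Linked (Adj G) (spine j ∷ cs) →
                  Adj G (last′ (spine j) cs) (spine i) → 2 ≤ length cs + (j ∸ i) → ContainsCycle G
    spine-cycle cs i≤j j≤L u off l close 2≤len =
      let (unique , linked , end , len) = spine-then cs i≤j j≤L u off l in
      cycle-from-list _ _ (subst (2 ≤_) (sym len) 2≤len) unique linked (subst (λ z → Adj G z _) (sym end) close)

    spine-loopedPath : ∀ {j} cs → j ≤ L → Unique cs → All OffSpine cs → Linked (Adj G) (spine j ∷ cs) →
                       Adj G (spine 0) (spine 0) → Adj G (last′ (spine j) cs) (last′ (spine j) cs) →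
                       1 ≤ length cs + j → ContainsLoopedPath G
    spine-loopedPath cs j≤L u off l loop₀ loop₁ 1≤len =
      let (unique , linked , end , len) = spine-then cs z≤n j≤L u off l in
      loopedPath-from-list _ _ (subst (1 ≤_) (sym len) 1≤len) unique linked loop₀
        (subst (λ z → Adj G z z) (sym end) loop₁)

    near≢ : ∀ {s r} → ¬ NearSpine s → NearSpine r → s ≢ r
    near≢ far near refl = far near

    nearSpine? : Decidable NearSpine
    nearSpine? v = Dec.map′ (λ (i , i<sL , a) → i , NP.≤-pred i<sL , a) (λ (i , i≤L , a) → i , s≤s i≤L , a)
                     (NP.anyUpTo? (λ i → Adj? v (spine i)) (suc L))

    onHair? : Decidable OnHair
    onHair? v = FP.any? λ r → (¬? (onSpine? r) ×-dec nearSpine? r) ×-dec Adj? v r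

    data Place (v : Fin n) : Set where
      on-spine : ∀ i → i ≤ L → spine i ≡ v → Place v
      hair     : OffSpine v → ∀ i → i ≤ L → Adj G v (spine i) → Place v
      tip      : OffSpine v → ¬ NearSpine v → ∀ r → Hair r → Adj G v r → Place v
      far      : Far v → Place v

    place : ∀ v → Place v
    place v with onSpine? v
    ... | yes (i , i≤L , e) = on-spine i i≤L e
    ... | no off with nearSpine? v
    ...   | yes (i , i≤L , a) = hair off i i≤L a
    ...   | no ¬near with onHair? v
    ...     | yes (r , hr , a) = tip off ¬near r hr a
    ...     | no ¬onHair       = far (off , ¬near , ¬onHair)

    -- The spine index of a spine vertex or a hair (junk 0 otherwise); a tip gets the position of its hair.
    foot : ∀ {v} → Place v → ℕ
    foot (on-spine i _ _) = i
    foot (hair _ i _ _)   = i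
    foot (tip _ _ _ _ _)  = 0
    foot (far _)          = 0

    posᴾ depᴾ : ∀ {v} → Place v → ℕ
    posᴾ (tip _ _ r _ _) = foot (place r)
    posᴾ P               = foot P
    depᴾ (on-spine _ _ _) = 0
    depᴾ (hair _ _ _ _)   = 1
    depᴾ (tip _ _ _ _ _)  = 2
    depᴾ (far _)          = 3

    -- Junk (the vertex itself) except for tips.
    parᴾ : ∀ {v} → Place v → Fin n
    parᴾ (tip _ _ r _ _) = r
    parᴾ {v} _           = v

    pos dep : Fin n → ℕ
    pos v = posᴾ (place v)
    dep v = depᴾ (place v)

    par : Fin n → Fin n
    par v = parᴾ (place v)

    Body : Region
    Body v = dep v ≤ 2

    foot≤L : ∀ {v} (P : Place v) → foot P ≤ L
    foot≤L (on-spine _ i≤L _) = i≤L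
    foot≤L (hair _ _ i≤L _)   = i≤L
    foot≤L (tip _ _ _ _ _)    = z≤n
    foot≤L (far _)            = z≤n

    posᴾ≤L : ∀ {v} (P : Place v) → posᴾ P ≤ L
    posᴾ≤L (tip _ _ r _ _)    = foot≤L (place r)
    posᴾ≤L P@(on-spine _ _ _) = foot≤L P
    posᴾ≤L P@(hair _ _ _ _)   = foot≤L P
    posᴾ≤L P@(far _)          = foot≤L P

    hair-place : ∀ {r} (P : Place r) → Hair r → depᴾ P ≡ 1 × posᴾ P ≡ foot P × Adj G r (spine (foot P))
    hair-place (on-spine i i≤L e)      (off , _)  = ⊥-elim (off (i , i≤L , e))
    hair-place (hair _ _ _ a)          _          = refl , refl , a
    hair-place (tip _ ¬near _ _ _)     (_ , near) = ⊥-elim (¬near near)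
    hair-place (far (_ , ¬near , _))   (_ , near) = ⊥-elim (¬near near)

    on-spine-place : ∀ {v i} (P : Place v) → i ≤ L → spine i ≡ v → depᴾ P ≡ 0 × posᴾ P ≡ i
    on-spine-place (on-spine j j≤L e) i≤L e' = refl , spine-inj j≤L i≤L (trans e (sym e'))
    on-spine-place (hair off _ _ _)   i≤L e  = ⊥-elim (off (_ , i≤L , e))
    on-spine-place (tip off _ _ _ _)  i≤L e  = ⊥-elim (off (_ , i≤L , e))
    on-spine-place (far (off , _))    i≤L e  = ⊥-elim (off (_ , i≤L , e))

    depth-place : ∀ {v} (P : Place v) → depᴾ P ≤ 2 → depᴾ P ≡ 0 ⊎ depᴾ P ≡ 1 ⊎ depᴾ P ≡ 2
    depth-place (on-spine _ _ _) _ = inj₁ refl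
    depth-place (hair _ _ _ _)   _ = inj₂ (inj₁ refl)
    depth-place (tip _ _ _ _ _)  _ = inj₂ (inj₂ refl)
    depth-place (far _) (s≤s (s≤s ()))

    spine-place : ∀ {v} (P : Place v) → depᴾ P ≡ 0 → v ≡ spine (posᴾ P)
    spine-place (on-spine _ _ e) _ = sym e

    hair-adj-place : ∀ {v} (P : Place v) → depᴾ P ≡ 1 → Adj G v (spine (posᴾ P))
    hair-adj-place (hair _ _ _ a) _ = a

    tip-parent-place : ∀ {v} (P : Place v) → depᴾ P ≡ 2 → Body (parᴾ P) × dep (parᴾ P) ≡ 1 × pos (parᴾ P) ≡ posᴾ P
    tip-parent-place (tip _ _ r hr _) _ =
      let (d , p , _) = hair-place (place r) hr in subst (_≤ 2) (sym d) (s≤s z≤n) , d , p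

    module Acyclic (acyclic : ¬ ContainsCycle G) where

      no-chord : ∀ {i j} → i < j → j ≤ L → Adj G (spine j) (spine i) → j ≡ suc i
      no-chord {i} {j} i<j j≤L a with j NP.≟ suc i
      ... | yes j≡si = j≡si
      ... | no  j≢si = ⊥-elim (acyclic (spine-cycle [] (NP.<⇒≤ i<j) j≤L [] [] [-] a
                         (NP.m+n≤o⇒m≤o∸n 2 (NP.≤∧≢⇒< i<j (≢-sym j≢si)))))

      spine-edge : ∀ {i j} → i ≤ L → j ≤ L → Adj G (spine i) (spine j) → spine i ≢ spine j → j ≡ suc i ⊎ i ≡ suc j
      spine-edge {i} {j} i≤L j≤L a ne with NP.<-cmp i j
      ... | tri≈ _ refl _ = ⊥-elim (ne refl)
      ... | tri< i<j _ _  = inj₁ (no-chord i<j j≤L (Adj-sym a))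
      ... | tri> _ _ j<i  = inj₂ (no-chord j<i i≤L a)

      two-feet : ∀ {v i j} → OffSpine v → i < j → j ≤ L → Adj G v (spine i) → Adj G v (spine j) → ⊥
      two-feet {v} off i<j j≤L ai aj =
        acyclic (spine-cycle (v ∷ []) (NP.<⇒≤ i<j) j≤L ([] ∷ []) (off ∷ []) (Adj-sym aj ∷ [-]) ai
                   (s≤s (NP.m<n⇒0<n∸m i<j)))

      foot-unique : ∀ {v i j} → OffSpine v → i ≤ L → j ≤ L → Adj G v (spine i) → Adj G v (spine j) → i ≡ j
      foot-unique {i = i} {j} off i≤L j≤L ai aj with NP.<-cmp i j
      ... | tri≈ _ i≡j _ = i≡j
      ... | tri< i<j _ _ = ⊥-elim (two-feet off i<j j≤L ai aj)
      ... | tri> _ _ j<i = ⊥-elim (two-feet off j<i i≤L aj ai)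

      foot-of-hair : ∀ {r i} → Hair r → Adj G r (spine i) → i ≤ L → foot (place r) ≡ i
      foot-of-hair {r} hr ai i≤L = let (_ , _ , a) = hair-place (place r) hr in
        foot-unique (proj₁ hr) (foot≤L (place _)) i≤L a ai

      hairs-apart : ∀ {u v} → Hair u → Hair v → u ≢ v → ¬ Adj G u v
      hairs-apart {u} {v} (off-u , i , i≤L , ai) (off-v , j , j≤L , aj) u≢v a with NP.≤-total i j
      ... | inj₁ i≤j = acyclic (spine-cycle (v ∷ u ∷ []) i≤j j≤L ((≢-sym u≢v ∷ []) ∷ [] ∷ []) (off-v ∷ off-u ∷ [])
                                  (Adj-sym aj ∷ Adj-sym a ∷ [-]) ai (s≤s (s≤s z≤n)))
      ... | inj₂ j≤i = acyclic (spine-cycle (u ∷ v ∷ []) j≤i i≤L ((u≢v ∷ []) ∷ [] ∷ []) (off-u ∷ off-v ∷ [])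
                                  (Adj-sym ai ∷ a ∷ [-]) aj (s≤s (s≤s z≤n)))

      hair-unique : ∀ {s r r'} → OffSpine s → ¬ NearSpine s → Hair r → Hair r' → Adj G s r → Adj G s r' → r ≡ r'
      hair-unique {s} {r} {r'} off-s ¬near-s hr hr' ar ar' with r F.≟ r'
      ... | yes r≡r' = r≡r'
      ... | no  r≢r' with hr | hr' | NP.≤-total (proj₁ (proj₂ hr)) (proj₁ (proj₂ hr'))
      ...   | off-r , i , i≤L , ai | off-r' , j , j≤L , aj | inj₁ i≤j =
        ⊥-elim (acyclic (spine-cycle (r' ∷ s ∷ r ∷ []) i≤j j≤L
          ((near≢ ¬near-s (j , j≤L , aj) ∘ sym ∷ ≢-sym r≢r' ∷ []) ∷ (near≢ ¬near-s (i , i≤L , ai) ∷ []) ∷ [] ∷ [])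
          (off-r' ∷ off-s ∷ off-r ∷ []) (Adj-sym aj ∷ Adj-sym ar' ∷ ar ∷ [-]) ai (s≤s (s≤s z≤n))))
      ...   | off-r , i , i≤L , ai | off-r' , j , j≤L , aj | inj₂ j≤i =
        ⊥-elim (acyclic (spine-cycle (r ∷ s ∷ r' ∷ []) j≤i i≤L
          ((near≢ ¬near-s (i , i≤L , ai) ∘ sym ∷ r≢r' ∷ []) ∷ (near≢ ¬near-s (j , j≤L , aj) ∷ []) ∷ [] ∷ [])
          (off-r ∷ off-s ∷ off-r' ∷ []) (Adj-sym ai ∷ Adj-sym ar ∷ ar' ∷ [-]) aj (s≤s (s≤s z≤n))))

      tips-apart : ∀ {s s'} → Tip s → Tip s' → s ≢ s' → ¬ Adj G s s'
      tips-apart {s} {s'} (off-s , ¬near-s , r , hr , ar) (off-s' , ¬near-s' , r' , hr' , ar') s≢s' a with r F.≟ r'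
      ... | yes refl = acyclic (cycle-from-list r (s ∷ s' ∷ []) ≤-refl
        ((≢-sym (near≢ ¬near-s near-r) ∷ ≢-sym (near≢ ¬near-s' near-r) ∷ []) ∷ (s≢s' ∷ []) ∷ [] ∷ [])
        (Adj-sym ar ∷ a ∷ [-]) ar')
        where
        near-r : NearSpine r
        near-r = proj₂ hr
      ... | no r≢r' with hr | hr' | NP.≤-total (proj₁ (proj₂ hr)) (proj₁ (proj₂ hr'))
      ...   | off-r , i , i≤L , ai | off-r' , j , j≤L , aj | inj₁ i≤j =
        acyclic (spine-cycle (r' ∷ s' ∷ s ∷ r ∷ []) i≤j j≤L
          ((≢-sym (near≢ ¬near-s' (j , j≤L , aj)) ∷ ≢-sym (near≢ ¬near-s (j , j≤L , aj)) ∷ ≢-sym r≢r' ∷ []) ∷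
           (≢-sym s≢s' ∷ near≢ ¬near-s' (i , i≤L , ai) ∷ []) ∷ (near≢ ¬near-s (i , i≤L , ai) ∷ []) ∷ [] ∷ [])
          (off-r' ∷ off-s' ∷ off-s ∷ off-r ∷ []) (Adj-sym aj ∷ Adj-sym ar' ∷ Adj-sym a ∷ ar ∷ [-]) ai
          (s≤s (s≤s z≤n)))
      ...   | off-r , i , i≤L , ai | off-r' , j , j≤L , aj | inj₂ j≤i =
        acyclic (spine-cycle (r ∷ s ∷ s' ∷ r' ∷ []) j≤i i≤L
          ((≢-sym (near≢ ¬near-s (i , i≤L , ai)) ∷ ≢-sym (near≢ ¬near-s' (i , i≤L , ai)) ∷ r≢r' ∷ []) ∷
           (s≢s' ∷ near≢ ¬near-s (j , j≤L , aj) ∷ []) ∷ (near≢ ¬near-s' (j , j≤L , aj) ∷ []) ∷ [] ∷ [])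
          (off-r ∷ off-s ∷ off-s' ∷ off-r' ∷ []) (Adj-sym ai ∷ Adj-sym ar ∷ a ∷ ar' ∷ [-]) aj (s≤s (s≤s z≤n)))

    module AsLobster (acyclic : ¬ ContainsCycle G) (no-violation : ∀ {s y} → Tip s → Far y → ¬ Adj G s y) where
      open Acyclic acyclic

      edge-place : ∀ {u v} (I : Place u) (J : Place v) → depᴾ I ≤ 2 → Adj G u v → u ≢ v →
                   depᴾ J ≤ 2 × EdgeKind u v (posᴾ I) (depᴾ I) (parᴾ I) (posᴾ J) (depᴾ J) (parᴾ J)
      edge-place (on-spine i i≤L refl) (on-spine j j≤L refl) _ a u≢v with spine-edge i≤L j≤L a u≢v
      ... | inj₁ j≡si = z≤n , spine-next refl refl j≡si
      ... | inj₂ i≡sj = z≤n , spine-prev refl refl i≡sj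
      edge-place (on-spine i i≤L refl) (hair off j j≤L aj) _ a _ =
        s≤s z≤n , spine-hair refl refl (foot-unique off j≤L i≤L aj (Adj-sym a))
      edge-place (on-spine i i≤L refl) (tip _ ¬near _ _ _)    _ a _ = ⊥-elim (¬near (i , i≤L , Adj-sym a))
      edge-place (on-spine i i≤L refl) (far (_ , ¬near , _)) _ a _ = ⊥-elim (¬near (i , i≤L , Adj-sym a))
      edge-place (hair off i i≤L ai) (on-spine j j≤L refl) _ a _ =
        z≤n , hair-spine refl refl (foot-unique off j≤L i≤L a ai)
      edge-place (hair off-u i i≤L ai) (hair off-v j j≤L aj) _ a u≢v =
        ⊥-elim (hairs-apart (off-u , i , i≤L , ai) (off-v , j , j≤L , aj) u≢v a)
      edge-place {u} (hair off-u i i≤L ai) (tip off-v ¬near r hr ar) _ a _ =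
        ≤-refl , hair-tip refl refl r≡u (foot-of-hair hr (subst (λ w → Adj G w (spine i)) (sym r≡u) ai) i≤L)
        where
        r≡u : r ≡ u
        r≡u = hair-unique off-v ¬near hr (off-u , i , i≤L , ai) ar (Adj-sym a)
      edge-place (hair off-u i i≤L ai) (far (_ , _ , ¬onHair)) _ a _ =
        ⊥-elim (¬onHair (_ , (off-u , i , i≤L , ai) , Adj-sym a))
      edge-place (tip _ ¬near _ _ _) (on-spine j j≤L refl) _ a _ = ⊥-elim (¬near (j , j≤L , a))
      edge-place {v = v} (tip off-u ¬near r hr ar) (hair off-v j j≤L aj) _ a _ =
        s≤s z≤n , tip-hair refl refl r≡v (sym (foot-of-hair hr (subst (λ w → Adj G w (spine j)) (sym r≡v) aj) j≤L))
        where
        r≡v : r ≡ v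
        r≡v = hair-unique off-u ¬near hr (off-v , j , j≤L , aj) ar a
      edge-place (tip off-u ¬near-u r hr ar) (tip off-v ¬near-v r' hr' ar') _ a u≢v =
        ⊥-elim (tips-apart (off-u , ¬near-u , r , hr , ar) (off-v , ¬near-v , r' , hr' , ar') u≢v a)
      edge-place (tip off-u ¬near r hr ar) (far f) _ a _ = ⊥-elim (no-violation (off-u , ¬near , r , hr , ar) f a)
      edge-place (far _) _ (s≤s (s≤s ())) _ _

      hairs : ℕ → List (Fin n)
      hairs i = filter (λ r → (dep r NP.≟ 1) ×-dec (pos r NP.≟ i)) (allFin n)

      lobster : Lobster
      lobster = record
        { Body = Body ; L = L ; spine = spine ; pos = pos ; dep = dep ; par = par
        ; colour = λ v → parity (pos v + dep v) ; hairs = hairs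
        ; pos≤L      = λ {v} _ → posᴾ≤L (place v)
        ; depth      = λ {v} → depth-place (place v)
        ; spine-pos  = λ {v} _ → spine-place (place v)
        ; spine-body = λ {i} i≤L → let (d , p) = on-spine-place (place (spine i)) i≤L refl in
                                   subst (_≤ 2) (sym d) z≤n , d , p
        ; spine-adj  = spine-adj
        ; hair-∈     = λ {v} _ d → ∈-filter⁺ _ (∈-allFin v) (d , refl)
        ; hairs-body = λ {_} {r} _ r∈ → let (d , p) = proj₂ (∈-filter⁻ _ {xs = allFin n} r∈) in
                                        subst (_≤ 2) (sym d) (s≤s z≤n) , d , p
        ; hair-adj   = λ {v} _ → hair-adj-place (place v)
        ; tip-parent = λ {v} _ → tip-parent-place (place v)
        ; edge       = λ {u} {v} → edge-place (place u) (place v)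
        ; proper     = λ {u} {v} u∈B a u≢v → parity-flips (proj₂ (edge-place (place u) (place v) u∈B a u≢v)) }

    loop-at-start : ¬ ContainsLoopedPath G → Adj G (spine 0) (spine 0) → ∀ {z} → Body z → Adj G z z → z ≡ spine 0
    loop-at-start no-loopedPath loop₀ {z} z∈B loop = at (place z) z∈B
      where
      at : (P : Place z) → depᴾ P ≤ 2 → z ≡ spine 0
      at (on-spine zero    _   e) _ = sym e
      at (on-spine (suc i) i≤L e) _ = ⊥-elim (no-loopedPath
        (spine-loopedPath [] i≤L [] [] [-] loop₀ (subst (λ w → Adj G w w) (sym e) loop) (s≤s z≤n)))
      at (hair off i i≤L a) _ = ⊥-elim (no-loopedPath
        (spine-loopedPath (z ∷ []) i≤L ([] ∷ []) (off ∷ []) (Adj-sym a ∷ [-]) loop₀ loop (s≤s z≤n)))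
      at (tip off ¬near r hr ar) _ = let (_ , _ , a) = hair-place (place r) hr in ⊥-elim (no-loopedPath
        (spine-loopedPath (r ∷ z ∷ []) (foot≤L (place r)) ((≢-sym (near≢ ¬near (proj₂ hr)) ∷ []) ∷ [] ∷ [])
          (proj₁ hr ∷ off ∷ []) (Adj-sym a ∷ Adj-sym ar ∷ [-]) loop₀ loop (s≤s z≤n)))
      at (far _) (s≤s (s≤s ()))

    spine-reachable : ∀ {i} → i ≤ L → Star (Adj G) (spine 0) (spine i)
    spine-reachable {zero}  _    = ε
    spine-reachable {suc i} si≤L = spine-reachable (NP.≤-trans (NP.n≤1+n i) si≤L) ◅◅ (spine-adj si≤L ◅ ε)

    body-reachable : ∀ {v} → Body v → Star (Adj G) (spine 0) v
    body-reachable {v} v∈B = reach (place v) v∈B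
      where
      reach : (P : Place v) → depᴾ P ≤ 2 → Star (Adj G) (spine 0) v
      reach (on-spine i i≤L e) _ = subst (Star (Adj G) (spine 0)) e (spine-reachable i≤L)
      reach (hair _ i i≤L a)   _ = spine-reachable i≤L ◅◅ (Adj-sym a ◅ ε)
      reach (tip _ _ r hr ar)  _ = let (_ , _ , a) = hair-place (place r) hr in
                                   spine-reachable (foot≤L (place r)) ◅◅ (Adj-sym a ◅ Adj-sym ar ◅ ε)
      reach (far _) (s≤s (s≤s ()))

  module _ {S : Spine} where
    open Spine S
    open Around S

    record Branch (j : ℕ) (y s r : Fin n) : Set where
      field
        j≤L   : j ≤ L
        off-y : OffSpine y
        off-s : OffSpine s
        off-r : OffSpine r
        y≢s   : y ≢ s
        y≢r   : y ≢ r
        s≢r   : s ≢ r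
        y~s   : Adj G y s
        s~r   : Adj G s r
        r~j   : Adj G r (spine j)

    tip-far⇒branch : ∀ {s y} → Tip s → Far y → Adj G s y → ∃₂ λ j r → Branch j y s r
    tip-far⇒branch (off-s , ¬near-s , r , hr@(off-r , j , j≤L , arj) , asr) (off-y , ¬near-y , ¬onHair-y) asy =
      j , r , record
        { j≤L = j≤L ; off-y = off-y ; off-s = off-s ; off-r = off-r
        ; y≢s = λ { refl → ¬onHair-y (r , hr , asr) }
        ; y≢r = λ { refl → ¬near-y (j , j≤L , arj) }
        ; s≢r = λ { refl → ¬near-s (j , j≤L , arj) }
        ; y~s = Adj-sym asy ; s~r = asr ; r~j = arj }

  reverse : Spine → Spine
  reverse S = record
    { L = L ; spine = λ i → spine (L ∸ i) ; spine-inj = inj ; spine-adj = reverse-path spine spine-adj }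
    where
    open Spine S
    inj : ∀ {i i'} → i ≤ L → i' ≤ L → spine (L ∸ i) ≡ spine (L ∸ i') → i ≡ i'
    inj {i} {i'} i≤L i'≤L e = NP.∸-cancelˡ-≡ i≤L i'≤L (spine-inj (NP.m∸n≤m L i) (NP.m∸n≤m L i') e)

  drop : (S : Spine) → ∀ j → j ≤ Spine.L S → Spine
  drop S j j≤L = record
    { L = L ∸ j ; spine = λ i → spine (i + j)
    ; spine-inj = λ i≤ i'≤ e → NP.+-cancelʳ-≡ j _ _ (spine-inj (bound i≤) (bound i'≤) e)
    ; spine-adj = λ si≤ → spine-adj (bound si≤) }
    where
    open Spine S
    bound : ∀ {i} → i ≤ L ∸ j → i + j ≤ L
    bound {i} = NP.m≤o∸n⇒m+n≤o i j≤L

  cons : ∀ x (S : Spine) → Around.OffSpine S x → Adj G x (Spine.spine S 0) → Spine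
  cons x S off a = record { L = suc L ; spine = spine′ ; spine-inj = inj ; spine-adj = adj }
    where
    open Spine S
    spine′ : ℕ → Fin n
    spine′ zero    = x
    spine′ (suc i) = spine i
    inj : ∀ {i i'} → i ≤ suc L → i' ≤ suc L → spine′ i ≡ spine′ i' → i ≡ i'
    inj {zero}  {zero}   _          _           _ = refl
    inj {zero}  {suc i'} _          (s≤s i'≤L)  e = ⊥-elim (off (i' , i'≤L , sym e))
    inj {suc i} {zero}   (s≤s i≤L)  _           e = ⊥-elim (off (i , i≤L , e))
    inj {suc i} {suc i'} (s≤s i≤L)  (s≤s i'≤L)  e = cong suc (spine-inj i≤L i'≤L e)
    adj : ∀ {i} → suc i ≤ suc L → Adj G (spine′ i) (spine′ (suc i))
    adj {zero}  _          = a
    adj {suc i} (s≤s si≤L) = spine-adj si≤L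

  on-cons : ∀ x S off a {v} → Around.OnSpine (cons x S off a) v → v ≡ x ⊎ Around.OnSpine S v
  on-cons _ _ _ _ (zero  , _         , e) = inj₁ (sym e)
  on-cons _ _ _ _ (suc i , s≤s i≤L , e) = inj₂ (i , i≤L , e)

  on-drop : ∀ S {j} j≤L {v} → Around.OnSpine (drop S j j≤L) v → Around.OnSpine S v
  on-drop S {j} j≤L (i , i≤ , e) = i + j , NP.m≤o∸n⇒m+n≤o i j≤L i≤ , e

  on-reverse : ∀ S {v} → Around.OnSpine (reverse S) v → Around.OnSpine S v
  on-reverse S (i , i≤L , e) = Spine.L S ∸ i , NP.m∸n≤m (Spine.L S) i , e

  -- The spine y, s, r, spine j, …, spine L.
  prepend : ∀ {S j y s r} → Branch {S} j y s r → Spine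
  prepend {S} {j} {y} {s} {r} b = cons y S₂ off-y₂ y~s
    where
    open Branch b
    S₀ : Spine
    S₀ = drop S j j≤L
    off-r₀ : Around.OffSpine S₀ r
    off-r₀ = off-r ∘ on-drop S j≤L
    S₁ : Spine
    S₁ = cons r S₀ off-r₀ r~j
    off-s₁ : Around.OffSpine S₁ s
    off-s₁ on = [ s≢r , off-s ∘ on-drop S j≤L ]′ (on-cons r S₀ off-r₀ r~j on)
    S₂ : Spine
    S₂ = cons s S₁ off-s₁ s~r
    off-y₂ : Around.OffSpine S₂ y
    off-y₂ on with on-cons s S₁ off-s₁ s~r on
    ... | inj₁ y≡s = y≢s y≡s
    ... | inj₂ on₁ with on-cons r S₀ off-r₀ r~j on₁
    ...   | inj₁ y≡r = y≢r y≡r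
    ...   | inj₂ on₀ = off-y (on-drop S j≤L on₀)

  reverse-branch : ∀ {S j y s r} → Branch {S} j y s r → Branch {reverse S} (Spine.L S ∸ j) y s r
  reverse-branch {S} {j} b = record
    { j≤L = NP.m∸n≤m L j
    ; off-y = off-y ∘ on-reverse S ; off-s = off-s ∘ on-reverse S ; off-r = off-r ∘ on-reverse S
    ; y≢s = y≢s ; y≢r = y≢r ; s≢r = s≢r ; y~s = y~s ; s~r = s~r
    ; r~j = subst (λ i → Adj G _ (spine i)) (sym (NP.m∸[m∸n]≡n j≤L)) r~j }
    where
    open Spine S
    open Branch b

  -- The spine spine 0, …, spine j, r, s, y.
  append : ∀ {S j y s r} → Branch {S} j y s r → Spine
  append b = reverse (prepend (reverse-branch b))

  append-L : ∀ {S j y s r} (b : Branch {S} j y s r) → Spine.L (append b) ≡ 3 + j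
  append-L b = cong (3 +_) (NP.m∸[m∸n]≡n (Branch.j≤L b))

  append-start : ∀ {S j y s r} (b : Branch {S} j y s r) → Spine.spine (append b) 0 ≡ Spine.spine S 0
  append-start {S} {j} b =
    cong spine (trans (cong (L ∸_) (NP.m∸n+n≡m (NP.m∸n≤m L j))) (NP.n∸n≡0 L))
    where open Spine S

  module _ {S : Spine} where
    open Spine S
    open Around S

    branch-unique : ∀ {j y s r} → Branch {S} j y s r → Unique (r ∷ s ∷ y ∷ [])
    branch-unique b = (≢-sym s≢r ∷ ≢-sym y≢r ∷ []) ∷ (≢-sym y≢s ∷ []) ∷ [] ∷ []
      where open Branch b

    branch-off : ∀ {j y s r} → Branch {S} j y s r → All OffSpine (r ∷ s ∷ y ∷ [])
    branch-off b = off-r ∷ off-s ∷ off-y ∷ []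
      where open Branch b

    -- In each pattern below, the vertices are listed as a spine segment followed by r, s, y;
    -- the table sends each vertex of the pattern to its place in that list.
    branch⇒H1 : ∀ {j y s r} → 3 ≤ j → j + 3 ≤ L → Branch {S} j y s r → ContainsPattern G 10 H1
    branch⇒H1 {y = y} {s} {r} (s≤s (s≤s (s≤s {n = k} _))) bound b =
      pattern-from-list H1 (segment k 6 ++ r ∷ s ∷ y ∷ [])
        (Vec.lookup (# 3 ∷ # 2 ∷ # 1 ∷ # 0 ∷ # 4 ∷ # 5 ∷ # 6 ∷ # 7 ∷ # 8 ∷ # 9 ∷ []))
        (segment-++-unique k 6 bound′ (branch-unique b) (branch-off b)) _
        (step (# 0) ∷ step (# 1) ∷ step (# 2) ∷ step (# 3) ∷ step (# 4) ∷ step (# 5) ∷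
         Adj-sym r~j ∷ Adj-sym s~r ∷ Adj-sym y~s ∷ [])
      where
      open Branch b
      bound′ : 6 + k ≤ L
      bound′ = subst (_≤ L) (cong (3 +_) (NP.+-comm k 3)) bound
      step : ∀ (t : Fin 6) → Adj G (spine (toℕ t + k)) (spine (suc (toℕ t) + k))
      step t = spine-step 6 t bound′

    branch⇒H2 : ∀ {y s r} → 5 ≤ L → Adj G (spine 0) (spine 0) → Branch {S} 2 y s r → ContainsPattern G 9 H2
    branch⇒H2 {y} {s} {r} bound loop b =
      pattern-from-list H2 (segment 0 5 ++ r ∷ s ∷ y ∷ [])
        (Vec.lookup (# 2 ∷ # 6 ∷ # 7 ∷ # 8 ∷ # 3 ∷ # 4 ∷ # 5 ∷ # 1 ∷ # 0 ∷ []))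
        (segment-++-unique 0 5 bound (branch-unique b) (branch-off b)) _
        (y~s ∷ s~r ∷ r~j ∷ step (# 2) ∷ step (# 3) ∷ step (# 4) ∷
         Adj-sym (step (# 1)) ∷ Adj-sym (step (# 0)) ∷ loop ∷ [])
      where
      open Branch b
      step : ∀ (t : Fin 5) → Adj G (spine (toℕ t + 0)) (spine (suc (toℕ t) + 0))
      step t = spine-step 5 t bound

    branch⇒H3 : ∀ {y s r} → 4 ≤ L → Adj G (spine 0) (spine 0) → Branch {S} 1 y s r → ContainsPattern G 8 H3
    branch⇒H3 {y} {s} {r} bound loop b =
      pattern-from-list H3 (segment 0 4 ++ r ∷ s ∷ y ∷ [])
        (Vec.lookup (# 1 ∷ # 5 ∷ # 6 ∷ # 7 ∷ # 2 ∷ # 3 ∷ # 4 ∷ # 0 ∷ []))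
        (segment-++-unique 0 4 bound (branch-unique b) (branch-off b)) _
        (y~s ∷ s~r ∷ r~j ∷ step (# 1) ∷ step (# 2) ∷ step (# 3) ∷ Adj-sym (step (# 0)) ∷ loop ∷ [])
      where
      open Branch b
      step : ∀ (t : Fin 4) → Adj G (spine (toℕ t + 0)) (spine (suc (toℕ t) + 0))
      step t = spine-step 4 t bound

    branch⇒H4 : ∀ {y s r} → 3 ≤ L → Adj G (spine 0) (spine 0) → Branch {S} 0 y s r → ContainsPattern G 7 H4
    branch⇒H4 {y} {s} {r} bound loop b =
      pattern-from-list H4 (segment 0 3 ++ r ∷ s ∷ y ∷ [])
        (Vec.lookup (# 0 ∷ # 4 ∷ # 5 ∷ # 6 ∷ # 1 ∷ # 2 ∷ # 3 ∷ []))
        (segment-++-unique 0 3 bound (branch-unique b) (branch-off b)) _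
        (y~s ∷ s~r ∷ r~j ∷ step (# 0) ∷ step (# 1) ∷ step (# 2) ∷ loop ∷ [])
      where
      open Branch b
      step : ∀ (t : Fin 3) → Adj G (spine (toℕ t + 0)) (spine (suc (toℕ t) + 0))
      step t = spine-step 3 t bound

  single : Fin n → Spine
  single v = record { L = 0 ; spine = λ _ → v ; spine-inj = λ { z≤n z≤n _ → refl } ; spine-adj = λ () }

  spine-bound : (S : Spine) → suc (Spine.L S) ≤ n
  spine-bound S = FP.injective⇒≤ {f = λ t → spine (toℕ t)} λ e → FP.toℕ-injective (spine-inj (below _) (below _) e)
    where
    open Spine S
    below : ∀ (t : Fin (suc L)) → toℕ t ≤ L
    below t = NP.≤-pred (FP.toℕ<n t)

  -- A tip next to a vertex at distance 3 from the spine.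
  Violation : Spine → Set
  Violation S = ∃₂ λ s y → Tip s × Far y × Adj G s y
    where open Around S

  violation? : ∀ S → Dec (Violation S)
  violation? S = FP.any? λ s → FP.any? λ y → tip? s ×-dec far? y ×-dec Adj? s y
    where
    open Around S
    tip? : Decidable Tip
    tip? v = ¬? (onSpine? v) ×-dec ¬? (nearSpine? v) ×-dec onHair? v
    far? : Decidable Far
    far? v = ¬? (onSpine? v) ×-dec ¬? (nearSpine? v) ×-dec ¬? (onHair? v)

  -- Lengthening the spine while a violation remains must stop, since a spine has at most n vertices.
  grow : (P : Spine → Set) → (∀ {S} → P S → Violation S → ∃[ S' ] (Spine.L S < Spine.L S' × P S')) →
         ∀ {S} → P S → ∃[ S' ] (P S' × ¬ Violation S')
  grow P extend p = go n p (NP.m≤m+n n _)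
    where
    go : ∀ fuel {S} → P S → n ≤ fuel + Spine.L S → ∃[ S' ] (P S' × ¬ Violation S')
    go fuel {S} p n≤ with violation? S
    ... | no none = S , p , none
    go zero    {S} p n≤ | yes _ = ⊥-elim (NP.<-irrefl refl (NP.<-≤-trans (spine-bound S) n≤))
    go (suc f) {S} p n≤ | yes v with extend p v
    ... | S' , longer , p' =
      go f p' (≤-trans n≤ (subst (_≤ f + Spine.L S') (NP.+-suc f (Spine.L S)) (NP.+-monoʳ-≤ f longer)))

module If {n : ℕ} (G : Graph n) (ok : ¬ Forbidden G) where
  open Graphs G
  open Shooting G
  open Lobsters G
  open Spines G

  -- A branch near the end of the spine lengthens it there; a branch elsewhere, together with the loop at
  -- spine 0, is one of H1, …, H4.
  extend-from-loop : ∀ {S} → Adj G (Spine.spine S 0) (Spine.spine S 0) → Violation S →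
                     ∃[ S' ] (Spine.L S < Spine.L S' × Spine.spine S' 0 ≡ Spine.spine S 0)
  extend-from-loop {S} loop (s , y , tip , far , a) with tip-far⇒branch tip far a
  ... | j , r , b with Spine.L S <? j + 3
  ... | yes L<j+3 =
    append b , subst (Spine.L S <_) (trans (NP.+-comm j 3) (sym (append-L b))) L<j+3 , append-start b
  ... | no  L≮j+3 = ⊥-elim (ok (forbidden j b (NP.≮⇒≥ L≮j+3)))
    where
    forbidden : ∀ j → Branch {S} j y s r → j + 3 ≤ Spine.L S → Forbidden G
    forbidden 0                   b bound = inj₂ (inj₂ (inj₂ (inj₂ (inj₂ (branch⇒H4 bound loop b)))))
    forbidden 1                   b bound = inj₂ (inj₂ (inj₂ (inj₂ (inj₁ (branch⇒H3 bound loop b)))))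
    forbidden 2                   b bound = inj₂ (inj₂ (inj₂ (inj₁ (branch⇒H2 bound loop b))))
    forbidden (suc (suc (suc k))) b bound = inj₂ (inj₂ (inj₁ (branch⇒H1 (s≤s (s≤s (s≤s (z≤n {k})))) bound b)))

  -- A branch near either end of the spine lengthens it; a branch far from both ends is H1.
  extend-from : ∀ {S v} → Star (Adj G) (Spine.spine S 0) v → Violation S →
                ∃[ S' ] (Spine.L S < Spine.L S' × Star (Adj G) (Spine.spine S' 0) v)
  extend-from {S} {v} reach (s , y , tip , far , a) with tip-far⇒branch {S} tip far a
  ... | j , r , b with j <? 3
  ...   | yes j<3 = prepend b , longer ,
                    (y~s ◅ s~r ◅ r~j ◅ Star.reverse Adj-sym (Around.spine-reachable S j≤L)) ◅◅ reach
    where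
    open Branch b
    longer : Spine.L S < 3 + (Spine.L S ∸ j)
    longer = subst (_< 3 + (Spine.L S ∸ j)) (NP.m+[n∸m]≡n j≤L) (NP.+-monoˡ-< (Spine.L S ∸ j) j<3)
  ...   | no j≮3 with Spine.L S <? j + 3
  ...     | yes L<j+3 = append b , subst (Spine.L S <_) (trans (NP.+-comm j 3) (sym (append-L b))) L<j+3 ,
                        subst (λ w → Star (Adj G) w v) (sym (append-start b)) reach
  ...     | no  L≮j+3 = ⊥-elim (ok (inj₂ (inj₂ (inj₁ (branch⇒H1 (NP.≮⇒≥ j≮3) (NP.≮⇒≥ L≮j+3) b)))))

  record Component (v : Fin n) : Set₁ where
    field
      C        : Region
      C?       : Decidable C
      C-closed : Closed C
      v∈C      : C v
      shots    : List (Fin n)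
      clears   : Clears C shots

  Loopless : Region → Set
  Loopless A = ∀ {u} → A u → ¬ Adj G u u

  lobster-component : ∀ {A v} → Closed A → A v → (S : Spine) → ¬ Violation S →
    Star (Adj G) (Spine.spine S 0) v → Adj G (Spine.spine S 0) (Spine.spine S 0) ⊎ Loopless A → Component v
  lobster-component {A} {v} clA v∈A S ok-S reach loop-or-none = record
    { C = Body ; C? = λ u → dep u ≤? 2 ; C-closed = body-closed
    ; v∈C = star-closed body-closed (proj₁ (Lobster.spine-body lobster z≤n)) reach
    ; shots = proj₁ cleared ; clears = proj₂ cleared }
    where
    open Spine S
    open Around S
    open AsLobster (ok ∘ inj₁) (λ tip far a → ok-S (_ , _ , tip , far , a))
    open Sweep lobster using (body-closed)
    Body⊆A : Body ⊆ A
    Body⊆A u∈B = star-closed clA (star-closed clA v∈A (Star.reverse Adj-sym reach)) (body-reachable u∈B)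
    loops : Adj G (spine 0) (spine 0) ⊎ Loopless A → ∀ {u} → Body u → Adj G u u → u ≡ spine 0
    loops (inj₁ loop₀)   = loop-at-start (ok ∘ inj₂ ∘ inj₁) loop₀
    loops (inj₂ no-loop) = λ u∈B loop → ⊥-elim (no-loop (Body⊆A u∈B) loop)
    cleared : ∃ (Clears Body)
    cleared = lobster-cleared lobster (loops loop-or-none)

  component : ∀ {A v} → Closed A → A v → Adj G v v ⊎ Loopless A → Component v
  component {v = v} clA v∈A (inj₁ loop) with grow (λ S → Spine.spine S 0 ≡ v) (λ {S} → extend {S}) {single v} refl
    where
    extend : ∀ {S} → Spine.spine S 0 ≡ v → Violation S → ∃[ S' ] (Spine.L S < Spine.L S' × Spine.spine S' 0 ≡ v)
    extend {S} start viol =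
      let (S' , longer , same) = extend-from-loop {S} (subst (λ w → Adj G w w) (sym start) loop) viol in
      S' , longer , trans same start
  ... | S , refl , ok-S = lobster-component clA v∈A S ok-S ε (inj₁ loop)
  component {v = v} clA v∈A (inj₂ loopless)
    with grow (λ S → Star (Adj G) (Spine.spine S 0) v) (λ {S} → extend-from {S}) {single v} ε
  ... | S , reach , ok-S = lobster-component clA v∈A S ok-S reach (inj₂ loopless)

  ∈-tail : ∀ {u v} {vs : List (Fin n)} → u ∈ v ∷ vs → u ≢ v → u ∈ vs
  ∈-tail (here u≡v)  u≢v = ⊥-elim (u≢v u≡v)
  ∈-tail (there u∈vs) _  = u∈vs

  -- Components with a loop are cleared first, each from a spine starting at the loop; then every
  -- remaining vertex starts the spine of its component.
  clear-loopless : ∀ vs {A} → Decidable A → Closed A → (∀ {u} → A u → u ∈ vs) → Loopless A → ∃ (Clears A)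
  clear-loopless []       _ _ listed _ = [] , λ _ u∈A → AnyP.¬Any[] (listed u∈A)
  clear-loopless (v ∷ vs) {A} A? clA listed loopless with A? v
  ... | no  v∉A = clear-loopless vs A? clA (λ u∈A → ∈-tail (listed u∈A) λ { refl → v∉A u∈A }) loopless
  ... | yes v∈A = shots ++ proj₁ rest , clears-++ C? clA C-closed shots (proj₁ rest) clears (proj₂ rest)
    where
    open Component (component clA v∈A (inj₂ loopless))
    rest : ∃ (Clears (A ∖ C))
    rest = clear-loopless vs (λ u → A? u ×-dec ¬? (C? u)) (∖-closed clA C-closed)
             (λ (u∈A , u∉C) → ∈-tail (listed u∈A) λ { refl → u∉C v∈C }) (λ (u∈A , _) → loopless u∈A)

  clear : ∀ vs {A} → Decidable A → Closed A → (∀ {u} → A u → Adj G u u → u ∈ vs) → ∃ (Clears A)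
  clear [] A? clA looped =
    clear-loopless (allFin n) A? clA (λ {u} _ → ∈-allFin u) λ u∈A loop → AnyP.¬Any[] (looped u∈A loop)
  clear (v ∷ vs) {A} A? clA looped with A? v ×-dec Adj? v v
  ... | no  ¬looped       = clear vs A? clA λ u∈A loop → ∈-tail (looped u∈A loop) λ { refl → ¬looped (u∈A , loop) }
  ... | yes (v∈A , loop) = shots ++ proj₁ rest , clears-++ C? clA C-closed shots (proj₁ rest) clears (proj₂ rest)
    where
    open Component (component clA v∈A (inj₁ loop))
    rest : ∃ (Clears (A ∖ C))
    rest = clear vs (λ u → A? u ×-dec ¬? (C? u)) (∖-closed clA C-closed)
             λ (u∈A , u∉C) loop' → ∈-tail (looped u∈A loop') λ { refl → u∉C v∈C }

  noForbidden⇒h≤1 : HuntingNumber≤ G 1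
  noForbidden⇒h≤1 = let (ws , cleared) = clear (allFin n) {U} (λ _ → yes tt) (λ _ _ → tt) λ {u} _ _ → ∈-allFin u in
                    clears⇒h≤1 ws cleared

theorem5 : {n : ℕ} (G : Graph n) →
    HuntingNumber≤ G 1 ⇔
      (¬ (ContainsCycle G ⊎ ContainsLoopedPath G ⊎ ContainsPattern G 10 H1
          ⊎ ContainsPattern G 9 H2 ⊎ ContainsPattern G 8 H3 ⊎ ContainsPattern G 7 H4))
theorem5 G = mk⇔ (OnlyIf.h≤1⇒noForbidden G) (If.noForbidden⇒h≤1 G)
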